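{- Let $\mathbf{d}=(d_1,\dots,d_n)$ be a non-increasing sequence of positive integers with $d_1+\dots+d_n=2(n-1)$ and let $\mathbf{w}=(\mu_1,\dots,\mu_n)$ be a sequence of \textbf{positive} reals. Let $T\in\mathcal{WT}(\mathbf{w},\mathbf{d})$ be an optimal caterpillar with backbone $v_1,\dots,v_q$, and for each $k=1,\dots,q$ let $u_k\in A_T(k)$ be an arbitrary pendent vertex associated with the $k$-th backbone position. Then the sequence $\mu_T(u_k)$, $k=1,\dots,q$, is V-shaped.
   Context: For a tree $T$, $d_T(v)$ denotes the degree of $v$ and $d_T(u,v)$ the distance. Pendent vertices have degree one; other vertices are internal. A vertex-weighted tree has weights $\mu_T(v)$ on vertices; $VWWI(T)=\frac12\sum_{u,v\in V(T)}\mu_T(u)\mu_T(v)d_T(u,v)$. The sequences are indexed so that $d_i=d_j$, $i<j$ implies $\mu_i\ge\mu_j$. $\mathcal{WT}(\mathbf{w},\mathbf{d})$ is the set of vertex-weighted trees whose vertices can be labeled $v_1,\dots,v_n$ with $d_T(v_i)=d_i$, $\mu_T(v_i)=\mu_i$. An optimal tree maximizes $VWWI$ over $\mathcal{WT}(\mathbf{w},\mathbf{d})$. A caterpillar is a tree such that removing all pendent vertices leaves a path $v_1,\dots,v_q$ (the backbone, listed in path order). A vertex $v$ is associated with backbone position $k$ if $v=v_k$, or $v$ is pendent and adjacent to $v_k$; $A_T(k)$ is the set of such vertices. A real sequence $a_1,\dots,a_q$ is V-shaped if there is $\underline{k}\in\{1,\dots,q\}$ with $a_k\ge a_{k+1}$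 for $k<\underline{k}$ and $a_k\le a_{k+1}$ for $\underline{k}\le k\le q-1$. -}

module Defs where

open import Level using (Level; _⊔_) renaming (suc to lsuc)
open import Data.Nat as ℕ using (ℕ; zero; suc; _∸_)
open import Data.Bool using (Bool; true; false; _∨_; _∧_; not; if_then_else_)
open import Data.Fin using (Fin; zero; suc; toℕ; _≟_)
open import Data.Product using (Σ; ∃; _×_; _,_)
open import Relation.Nullary using (¬_; does)
open import Relation.Binary using (Rel; IsTotalOrder)
open import Relation.Binary.PropositionalEquality using (_≡_; _≢_)
open import Function.Definitions using (Injective)
open import Algebra.Bundles using (CommutativeRing)

-- Ordered fields (the reals are an instance).

record OrderedField (c ℓ : Level) : Set (lsuc (c ⊔ ℓ)) where
  field
    commutativeRing : CommutativeRing c ℓ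
  open CommutativeRing commutativeRing public
    using (Carrier; _≈_; _+_; _*_; -_; 0#; 1#)
  infix 4 _≤_ _<_
  field
    _≤_          : Rel Carrier ℓ
    isTotalOrder : IsTotalOrder _≈_ _≤_
    +-monoˡ-≤    : ∀ {x y} z → x ≤ y → x + z ≤ y + z
    *-nonneg     : ∀ {x y} → 0# ≤ x → 0# ≤ y → 0# ≤ x * y
    0≉1          : ¬ (0# ≈ 1#)
    inverse      : ∀ x → ¬ (x ≈ 0#) → Σ Carrier (λ y → x * y ≈ 1#)

  _<_ : Rel Carrier ℓ
  x < y = (x ≤ y) × ¬ (x ≈ y)


sumℕ : ∀ {n} → (Fin n → ℕ) → ℕ
sumℕ {zero}  f = 0
sumℕ {suc n} f = f zero ℕ.+ sumℕ (λ i → f (suc i))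

count : ∀ {n} → (Fin n → Bool) → ℕ
count p = sumℕ (λ i → if′ (p i))
  where
  if′ : Bool → ℕ
  if′ true  = 1
  if′ false = 0

anyF : ∀ {n} → (Fin n → Bool) → Bool
anyF {zero}  p = false
anyF {suc n} p = p zero ∨ anyF (λ i → p (suc i))

countℕ : ℕ → (ℕ → Bool) → ℕ
countℕ zero    p = 0
countℕ (suc m) p = countℕ m p ℕ.+ (if p m then 1 else 0) 
-- Simple graphs on the vertex set Fin n, given by a Boolean adjacency
-- relation (vertex i plays the role of the paper's v_i).

Adj : ℕ → Set
Adj n = Fin n → Fin n → Bool

module _ {n : ℕ} (adj : Adj n) where

  deg : Fin n → ℕ
  deg v = count (adj v)

  reach : ℕ → Fin n → Fin n → Bool
  reach zero    u v = does (u ≟ v)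
  reach (suc k) u v = reach k u v ∨ anyF (λ w → reach k u w ∧ adj w v)

  -- graph distance d_T(u,v): the least k with a walk of length ≤ k,
  -- computed as #{k < n : no walk of length ≤ k}.  In a connected graph
  -- on n vertices every distance is ≤ n-1, so this is the usual distance.
  dist : Fin n → Fin n → ℕ
  dist u v = countℕ n (λ k → not (reach k u v))

  Connected : Set
  Connected = ∀ u v → reach n u v ≡ true

  record IsTree : Set where
    field
      symmetric  : ∀ u v → adj u v ≡ adj v u
      loopless   : ∀ u → adj u u ≡ false
      connected  : Connected
      edgeCount  : sumℕ deg ≡ 2 ℕ.* (n ∸ 1)

  Pendent : Fin n → Set
  Pendent v = deg v ≡ 1

  -- b : Fin q → Fin n lists the backbone v_1,…,v_q (0-indexed) of a
  -- caterpillar: removing all pendent vertices leaves exactly the path b.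
  record IsCaterpillarBackbone (q : ℕ) (b : Fin q → Fin n) : Set where
    field
      nonempty     : 1 ℕ.≤ q
      injective    : Injective _≡_ _≡_ b
      consecutive  : ∀ (i j : Fin q) → toℕ j ≡ suc (toℕ i) → adj (b i) (b j) ≡ true
      internal⇒on  : ∀ v → ¬ Pendent v → ∃ λ i → b i ≡ v
      on⇒internal  : ∀ i → ¬ Pendent (b i)

module _ {c ℓ} (F : OrderedField c ℓ) where
  open OrderedField F
  fromℕ : ℕ → Carrier
  fromℕ zero    = 0#
  fromℕ (suc k) = 1# + fromℕ k

  sumF : ∀ {n} → (Fin n → Carrier) → Carrier
  sumF {zero}  f = 0#
  sumF {suc n} f = f zero + sumF (λ i → f (suc i))


  -- 2·VWWI(T) = Σ_{u,v} μ(u) μ(v) d_T(u,v)  (sum over ordered pairs;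
  -- the factor 1/2 is dropped, which does not affect maximisation)
  twiceVWWI : ∀ {n} → Adj n → (Fin n → Carrier) → Carrier
  twiceVWWI adj μ = sumF (λ u → sumF (λ v → μ u * μ v * fromℕ (dist adj u v)))

  -- T ∈ WT(w,d): vertex i has degree d i (and weight μ i)
  InWT : ∀ {n} → (Fin n → ℕ) → Adj n → Set
  InWT d adj = IsTree adj × (∀ i → deg adj i ≡ d i)

  Optimal : ∀ {n} → (Fin n → Carrier) → (Fin n → ℕ) → Adj n → Set ℓ
  Optimal μ d adj = InWT d adj ×
    (∀ adj′ → InWT d adj′ → twiceVWWI adj′ μ ≤ twiceVWWI adj μ)

  VShaped : ∀ {q} → (Fin q → Carrier) → Set ℓ
  VShaped {q} a = ∃ λ (m : Fin q) → ∀ (i j : Fin q) → toℕ j ≡ suc (toℕ i) →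
    ((toℕ j ℕ.≤ toℕ m → a j ≤ a i) × (toℕ m ℕ.≤ toℕ i → a i ≤ a j))

module Submission where

-- Exchanging two vertices x, y of equal degree keeps a tree in WT(w, d), so in
-- an optimal tree it cannot increase 2·VWWI; expanding the change gives
-- (μ x − μ y)(T x − T y) ≥ 0, T z being the weighted two-way distance from z to
-- the other vertices.  For pendent vertices u_i, u_j, u_l at backbone positions
-- i < j < l, exchange u_j with u_i and with u_l.  In a caterpillar the distance
-- from u_k to w is |pos w − k| plus 1 or 2, so convexity of |p − ·| makes the
-- combination (l − j)·T₁ + (j − i)·T₂ separate strictly, and μ(u_l) ≤ μ(u_i)
-- forces μ(u_j) ≤ μ(u_i).  With its mirror image (the reversed backbone) this
-- splits the sequence at a minimum into a decreasing and an increasing part.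

open import Defs
open import Data.Nat as ℕ using (ℕ; zero; suc; _∸_; z≤n; s≤s; ∣_-_∣; _⊓_; _≤′_; ≤′-refl; ≤′-step)
import Data.Nat.Properties as ℕₚ
open import Data.Bool using (Bool; true; false; _∨_; _∧_; not; if_then_else_)
open import Data.Bool.Properties using (∨-zeroʳ)
open import Data.Fin using (Fin; zero; suc; toℕ; fromℕ<; opposite; _≟_)
open import Data.Fin.Properties
  using (any?; toℕ-fromℕ<; toℕ-injective; toℕ<n; injective⇒≤; opposite-prop; opposite-involutive)
open import Data.Fin.Permutation as Perm using (Permutation; _⟨$⟩ʳ_; _⟨$⟩ˡ_; inverseˡ; inverseʳ)
import Data.Fin.Permutation.Components as PC
open import Data.Product using (Σ; ∃; _×_; _,_; proj₁; proj₂)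
open import Data.Sum using (_⊎_; inj₁; inj₂)
open import Data.Empty using (⊥; ⊥-elim)
open import Function using (_∘_; _∋_)
open import Relation.Nullary using (¬_; Dec; does; yes; no)
open import Relation.Nullary.Decidable using (dec-true; dec-false)
open import Relation.Binary using (IsTotalOrder)
open import Relation.Binary.PropositionalEquality
  using (_≡_; _≢_; refl; sym; trans; cong; cong₂; subst; subst₂; module ≡-Reasoning)
open import Algebra.Bundles using (CommutativeRing)
import Algebra.Properties.CommutativeMonoid.Sum ℕₚ.+-0-commutativeMonoid as ℕΣ
import Algebra.Properties.Ring as RingProperties
import Relation.Binary.Reasoning.Setoid as ≈-Reasoning

bool-ext : ∀ {a b : Bool} → (a ≡ true → b ≡ true) → (b ≡ true → a ≡ true) → a ≡ b
bool-ext {true}  {true}  _ _ = refl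
bool-ext {true}  {false} f _ = sym (f refl)
bool-ext {false} {true}  _ g = g refl
bool-ext {false} {false} _ _ = refl

∧-true : ∀ {a b} → a ∧ b ≡ true → a ≡ true × b ≡ true
∧-true {true} {true} _ = refl , refl

anyF-witness : ∀ {n} (p : Fin n → Bool) → anyF p ≡ true → ∃ λ k → p k ≡ true
anyF-witness {suc n} p any with p zero in eq
... | true  = zero , eq
... | false with anyF-witness (p ∘ suc) any
...   | k , pk = suc k , pk

anyF-cong : ∀ {n} {p p′ : Fin n → Bool} → (∀ k → p k ≡ p′ k) → anyF p ≡ anyF p′
anyF-cong {zero}  p≡p′ = refl
anyF-cong {suc n} p≡p′ = cong₂ _∨_ (p≡p′ zero) (anyF-cong (p≡p′ ∘ suc))

anyF-intro : ∀ {n} (p : Fin n → Bool) k → p k ≡ true → anyF p ≡ true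
anyF-intro p zero    pk rewrite pk = refl
anyF-intro p (suc k) pk with p zero
... | true  = refl
... | false = anyF-intro (p ∘ suc) k pk

dist-cong : ∀ {n} {adj adj′ : Adj n} {s t s′ t′} →
  (∀ k → reach adj k s t ≡ reach adj′ k s′ t′) → dist adj s t ≡ dist adj′ s′ t′
dist-cong {n} {adj} {adj′} {s} {t} {s′} {t′} same = go n
  where
  go : ∀ N → countℕ N (λ k → not (reach adj k s t)) ≡ countℕ N (λ k → not (reach adj′ k s′ t′))
  go zero    = refl
  go (suc N) = cong₂ ℕ._+_ (go N) (cong (λ b → if not b then 1 else 0) (same N))

module NatSums where

  open import Data.Nat using (_+_; _*_; _≤_; _<_)
  open ℕₚ hiding (_≟_)

  indicator : Bool → ℕ
  indicator true  = 1
  indicator false = 0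

  sumℕ-cong : ∀ {n} {f g : Fin n → ℕ} → (∀ i → f i ≡ g i) → sumℕ f ≡ sumℕ g
  sumℕ-cong {zero}  f≡g = refl
  sumℕ-cong {suc n} f≡g = cong₂ _+_ (f≡g zero) (sumℕ-cong (f≡g ∘ suc))

  -- `sumℕ` agrees with the library's sum over (ℕ, +, 0), whose algebraic
  -- properties we reuse.
  sumℕ≡∑ : ∀ {n} (f : Fin n → ℕ) → sumℕ f ≡ ℕΣ.sum f
  sumℕ≡∑ {zero}  f = refl
  sumℕ≡∑ {suc n} f = cong (f zero +_) (sumℕ≡∑ (f ∘ suc))

  sumℕ-+ : ∀ {n} (f g : Fin n → ℕ) → sumℕ (λ i → f i + g i) ≡ sumℕ f + sumℕ g
  sumℕ-+ f g rewrite sumℕ≡∑ (λ i → f i + g i) | sumℕ≡∑ f | sumℕ≡∑ g = ℕΣ.∑-distrib-+ f g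

  sumℕ-comm : ∀ {n} (f : Fin n → Fin n → ℕ) →
    sumℕ (λ i → sumℕ (f i)) ≡ sumℕ (λ j → sumℕ (λ i → f i j))
  sumℕ-comm f = begin
    sumℕ (λ i → sumℕ (f i))                ≡⟨ sumℕ-cong (λ i → sumℕ≡∑ (f i)) ⟩
    sumℕ (λ i → ℕΣ.sum (f i))              ≡⟨ sumℕ≡∑ (λ i → ℕΣ.sum (f i)) ⟩
    ℕΣ.sum (λ i → ℕΣ.sum (f i))            ≡⟨ ℕΣ.∑-comm f ⟩
    ℕΣ.sum (λ j → ℕΣ.sum (λ i → f i j))    ≡⟨ sumℕ≡∑ (λ j → ℕΣ.sum (λ i → f i j)) ⟨
    sumℕ (λ j → ℕΣ.sum (λ i → f i j))      ≡⟨ sumℕ-cong (λ j → sumℕ≡∑ (λ i → f i j)) ⟨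
    sumℕ (λ j → sumℕ (λ i → f i j))        ∎
    where open ≡-Reasoning

  sumℕ-permute : ∀ {n} (f : Fin n → ℕ) (π : Permutation n n) → sumℕ (λ i → f (π ⟨$⟩ʳ i)) ≡ sumℕ f
  sumℕ-permute f π rewrite sumℕ≡∑ (λ i → f (π ⟨$⟩ʳ i)) | sumℕ≡∑ f = sym (ℕΣ.sum-permute f π)

  sumℕ-mono : ∀ {n} {f g : Fin n → ℕ} → (∀ i → f i ≤ g i) → sumℕ f ≤ sumℕ g
  sumℕ-mono {zero}  f≤g = z≤n
  sumℕ-mono {suc n} f≤g = +-mono-≤ (f≤g zero) (sumℕ-mono (f≤g ∘ suc))

  sumℕ-mono-< : ∀ {n} {f g : Fin n → ℕ} → (∀ i → f i ≤ g i) → ∀ k → f k < g k → sumℕ f < sumℕ g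
  sumℕ-mono-< f≤g zero    fk<gk = +-mono-<-≤ fk<gk (sumℕ-mono (f≤g ∘ suc))
  sumℕ-mono-< f≤g (suc k) fk<gk = +-mono-≤-< (f≤g zero) (sumℕ-mono-< (f≤g ∘ suc) k fk<gk)

  sumℕ-tight : ∀ {n} {f g : Fin n → ℕ} → (∀ i → f i ≤ g i) → sumℕ g ≤ sumℕ f → ∀ k → f k ≡ g k
  sumℕ-tight f≤g Σg≤Σf k with m≤n⇒m<n∨m≡n (f≤g k)
  ... | inj₁ fk<gk = ⊥-elim (<⇒≱ (sumℕ-mono-< f≤g k fk<gk) Σg≤Σf)
  ... | inj₂ fk≡gk = fk≡gk

  sumℕ-point : ∀ {n} (f : Fin n → ℕ) k → f k ≤ sumℕ f
  sumℕ-point f zero    = m≤m+n _ _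
  sumℕ-point f (suc k) = ≤-trans (sumℕ-point (f ∘ suc) k) (m≤n+m _ _)

  sumℕ-two-points : ∀ {n} (f : Fin n → ℕ) {i j} → i ≢ j → f i + f j ≤ sumℕ f
  sumℕ-two-points f {zero}  {zero}  i≢j = ⊥-elim (i≢j refl)
  sumℕ-two-points f {zero}  {suc j} _   = +-monoʳ-≤ (f zero) (sumℕ-point (f ∘ suc) j)
  sumℕ-two-points f {suc i} {zero}  _   =
    subst (_≤ sumℕ f) (+-comm (f zero) (f (suc i))) (+-monoʳ-≤ (f zero) (sumℕ-point (f ∘ suc) i))
  sumℕ-two-points f {suc i} {suc j} i≢j =
    ≤-trans (sumℕ-two-points (f ∘ suc) (i≢j ∘ cong suc)) (m≤n+m _ _)

  sumℕ-witness : ∀ {n} (f : Fin n → ℕ) → 0 < sumℕ f → ∃ λ k → 0 < f k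
  sumℕ-witness {suc n} f 0<Σ with f zero in eq
  ... | suc _ = zero , subst (0 <_) (sym eq) (s≤s z≤n)
  ... | zero  with sumℕ-witness (f ∘ suc) 0<Σ
  ...   | k , 0<fk = suc k , 0<fk

  count≡sumℕ : ∀ {n} (p : Fin n → Bool) → count p ≡ sumℕ (indicator ∘ p)
  count≡sumℕ {zero}  p = refl
  count≡sumℕ {suc n} p with p zero
  ... | true  = cong suc (count≡sumℕ (p ∘ suc))
  ... | false = count≡sumℕ (p ∘ suc)

  count-permute : ∀ {n} (p : Fin n → Bool) (π : Permutation n n) → count (λ i → p (π ⟨$⟩ʳ i)) ≡ count p
  count-permute p π = begin
    count (λ i → p (π ⟨$⟩ʳ i))           ≡⟨ count≡sumℕ (λ i → p (π ⟨$⟩ʳ i)) ⟩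
    sumℕ (λ i → indicator (p (π ⟨$⟩ʳ i))) ≡⟨ sumℕ-permute (indicator ∘ p) π ⟩
    sumℕ (indicator ∘ p)                   ≡⟨ count≡sumℕ p ⟨
    count p                                ∎
    where open ≡-Reasoning

  count-one-witness : ∀ {n} (p : Fin n → Bool) → count p ≡ 1 → ∃ λ k → p k ≡ true
  count-one-witness p c₁
    with sumℕ-witness (indicator ∘ p) (subst (0 <_) (trans (sym c₁) (count≡sumℕ p)) (s≤s z≤n))
  ... | k , 0<ind = k , indicator-pos (p k) 0<ind
    where
    indicator-pos : ∀ b → 0 < indicator b → b ≡ true
    indicator-pos true _ = refl

  count-one-unique : ∀ {n} (p : Fin n → Bool) → count p ≡ 1 → ∀ {i j} → p i ≡ true → p j ≡ true → i ≡ j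
  count-one-unique p c₁ {i} {j} pi pj with i ≟ j
  ... | yes i≡j = i≡j
  ... | no  i≢j = ⊥-elim (<⇒≱ (s≤s (s≤s z≤n)) two≤one)
    where
    two≤one : 2 ≤ 1
    two≤one = begin
      2                                          ≡⟨ cong₂ _+_ (cong indicator pi) (cong indicator pj) ⟨
      indicator (p i) + indicator (p j)          ≤⟨ sumℕ-two-points (indicator ∘ p) i≢j ⟩
      sumℕ (indicator ∘ p)                       ≡⟨ count≡sumℕ p ⟨
      count p                                    ≡⟨ c₁ ⟩
      1                                          ∎
      where open ≤-Reasoning

  sumℕ-zeros : ∀ {n} → sumℕ {n} (λ _ → 0) ≡ 0
  sumℕ-zeros {zero}  = refl
  sumℕ-zeros {suc n} = sumℕ-zeros {n}

  sumℕ-ones : ∀ {n} → sumℕ {n} (λ _ → 1) ≡ n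
  sumℕ-ones {zero}  = refl
  sumℕ-ones {suc n} = cong suc (sumℕ-ones {n})

  sumℕ-delta : ∀ {n} (r : Fin n) → sumℕ (λ w → indicator (does (w ≟ r))) ≡ 1
  sumℕ-delta {suc n} zero    = cong suc (sumℕ-zeros {n})
  sumℕ-delta {suc n} (suc r) = sumℕ-delta r

  sumℕ-all-but : ∀ {n} (r : Fin n) → sumℕ (λ w → indicator (not (does (w ≟ r)))) ≡ n ∸ 1
  sumℕ-all-but {suc n}       zero    = sumℕ-ones {n}
  sumℕ-all-but {suc (suc n)} (suc r) = cong suc (sumℕ-all-but r)

open NatSums

module Walks {n : ℕ} (adj : Adj n) where

  open import Data.Nat using (_+_; _≤_; _<_)
  open ℕₚ hiding (_≟_)

  record Reach (k : ℕ) (s t : Fin n) : Set where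
    constructor walk
    field reaches : reach adj k s t ≡ true

  reach-refl : ∀ s → Reach 0 s s
  reach-refl s = walk (dec-true (s ≟ s) refl)

  reach-zero : ∀ {s t} → Reach 0 s t → s ≡ t
  reach-zero {s} {t} (walk r) with s ≟ t
  ... | yes s≡t = s≡t

  reach-split : ∀ {k s t} → Reach (suc k) s t →
    Reach k s t ⊎ ∃ λ w → Reach k s w × adj w t ≡ true
  reach-split {k} {s} {t} (walk r) with reach adj k s t in eq
  ... | true  = inj₁ (walk eq)
  ... | false with anyF-witness _ r
  ...   | w , rw∧a = let rw , a = ∧-true rw∧a in inj₂ (w , walk rw , a)

  reach-suc : ∀ {k s t} → Reach k s t → Reach (suc k) s t
  reach-suc {k} {s} {t} (walk r) = walk (cong (_∨ anyF (λ w → reach adj k s w ∧ adj w t)) r)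

  reach-weaken : ∀ {k k′ s t} → k ≤ k′ → Reach k s t → Reach k′ s t
  reach-weaken {k} {s = s} {t} k≤k′ r = go (≤⇒≤′ k≤k′)
    where
    go : ∀ {k′} → k ≤′ k′ → Reach k′ s t
    go ≤′-refl      = r
    go (≤′-step le) = reach-suc (go le)

  reach-snoc : ∀ {k s t r} → Reach k s t → adj t r ≡ true → Reach (suc k) s r
  reach-snoc {k} {s} {t} {r} (walk rst) atr = walk
    (trans (cong (reach adj k s r ∨_) (anyF-intro (λ w → reach adj k s w ∧ adj w r) t (cong₂ _∧_ rst atr)))
           (∨-zeroʳ _))

  reach-edge : ∀ {s t} → adj s t ≡ true → Reach 1 s t
  reach-edge = reach-snoc (reach-refl _)

  reach-trans : ∀ {a c s t r} → Reach a s t → Reach c t r → Reach (a + c) s r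
  reach-trans {a} {zero}  rst rtr = subst (Reach (a + 0) _) (reach-zero rtr) (reach-weaken (m≤m+n a 0) rst)
  reach-trans {a} {suc c} rst rtr with reach-split rtr
  ... | inj₁ rtr′            = reach-weaken (+-monoʳ-≤ a (n≤1+n c)) (reach-trans {c = c} rst rtr′)
  ... | inj₂ (w , rtw , awr) = reach-weaken (≤-reflexive (sym (+-suc a c))) (reach-snoc (reach-trans {c = c} rst rtw) awr)

  reach-sym : (∀ s t → adj s t ≡ adj t s) → ∀ {k s t} → Reach k s t → Reach k t s
  reach-sym adj-sym {zero}  rst = subst (λ t → Reach 0 t _) (reach-zero rst) (reach-refl _)
  reach-sym adj-sym {suc k} {s} {t} rst with reach-split rst
  ... | inj₁ rst′            = reach-suc (reach-sym adj-sym rst′)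
  ... | inj₂ (w , rsw , awt) = reach-trans (reach-edge (trans (adj-sym t w) awt)) (reach-sym adj-sym rsw)

  reach-closed : (S : Fin n → Bool) → (∀ s t → S s ≡ true → adj s t ≡ true → S t ≡ true) →
    ∀ {k s t} → S s ≡ true → Reach k s t → S t ≡ true
  reach-closed S closed {zero}  Ss rst = subst (λ t → S t ≡ true) (reach-zero rst) Ss
  reach-closed S closed {suc k} Ss rst with reach-split rst
  ... | inj₁ rst′            = reach-closed S closed Ss rst′
  ... | inj₂ (w , rsw , awt) = closed w _ (reach-closed S closed Ss rsw) awt

  reach-lower : (g : Fin n → ℕ) → (∀ s t → adj s t ≡ true → g t ≤ suc (g s)) →
    ∀ {k s t} → Reach k s t → g t ≤ g s + k
  reach-lower g lip {zero}  {s} rst = subst (λ t → g t ≤ g s + 0) (reach-zero rst) (m≤m+n (g s) 0)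
  reach-lower g lip {suc k} {s} {t} rst with reach-split rst
  ... | inj₁ rst′            = ≤-trans (reach-lower g lip rst′) (+-monoʳ-≤ (g s) (n≤1+n k))
  ... | inj₂ (w , rsw , awt) = begin
    g t            ≤⟨ lip w t awt ⟩
    suc (g w)      ≤⟨ s≤s (reach-lower g lip rsw) ⟩
    suc (g s + k)  ≡⟨ +-suc (g s) k ⟨
    g s + suc k    ∎
    where open ≤-Reasoning

  countℕ-threshold : ∀ (p : ℕ → Bool) h → (∀ k → k < h → p k ≡ true) → (∀ k → h ≤ k → p k ≡ false) →
    ∀ N → countℕ N p ≡ N ⊓ h
  countℕ-threshold p h below above zero = refl
  countℕ-threshold p h below above (suc N) with N <? h
    where open import Data.Nat using (_<?_)
  ... | yes N<h rewrite below N N<h | countℕ-threshold p h below above N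
                      | m≤n⇒m⊓n≡m (<⇒≤ N<h) | m≤n⇒m⊓n≡m N<h = +-comm N 1
  ... | no N≮h  rewrite above N (≮⇒≥ N≮h) | countℕ-threshold p h below above N
                      | m≥n⇒m⊓n≡n (≮⇒≥ N≮h) | m≥n⇒m⊓n≡n (m≤n⇒m≤1+n (≮⇒≥ N≮h)) = +-identityʳ h

  dist-exact : ∀ {h s t} → h ≤ n → Reach h s t → (∀ k → Reach k s t → h ≤ k) → dist adj s t ≡ h
  dist-exact {h} {s} {t} h≤n rh@(walk rh′) least =
    trans (countℕ-threshold _ h below above n) (m≥n⇒m⊓n≡n h≤n)
    where
    below : ∀ k → k < h → not (reach adj k s t) ≡ true
    below k k<h with reach adj k s t in eq
    ... | true  = ⊥-elim (<⇒≱ k<h (least k (walk eq)))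
    ... | false = refl
    above : ∀ k → h ≤ k → not (reach adj k s t) ≡ false
    above k h≤k rewrite Reach.reaches (reach-weaken h≤k rh) = refl

  dist-self : ∀ s → dist adj s s ≡ 0
  dist-self s = dist-exact z≤n (reach-refl s) (λ _ _ → z≤n)

  dist-sym : (∀ s t → adj s t ≡ adj t s) → ∀ s t → dist adj s t ≡ dist adj t s
  dist-sym adj-sym s t = dist-cong same
    where
    flip : ∀ {k a c} → reach adj k a c ≡ true → reach adj k c a ≡ true
    flip {k} {a} {c} r = Reach.reaches (reach-sym adj-sym {k} {a} {c} (walk r))
    same : ∀ k → reach adj k s t ≡ reach adj k t s
    same k = bool-ext (flip {k} {s} {t}) (flip {k} {t} {s})

module Relabel {n : ℕ} (adj : Adj n) (π : Permutation n n) where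

  open import Data.Nat using (_*_)

  relabelled : Adj n
  relabelled s t = adj (π ⟨$⟩ʳ s) (π ⟨$⟩ʳ t)

  private
    ρ-injective : ∀ {s t} → π ⟨$⟩ʳ s ≡ π ⟨$⟩ʳ t → s ≡ t
    ρ-injective {s} {t} e = trans (sym (inverseˡ π)) (trans (cong (π ⟨$⟩ˡ_) e) (inverseˡ π))

    does-relabel : ∀ s t → does (s ≟ t) ≡ does (π ⟨$⟩ʳ s ≟ π ⟨$⟩ʳ t)
    does-relabel s t with s ≟ t | π ⟨$⟩ʳ s ≟ π ⟨$⟩ʳ t
    ... | yes _   | yes _   = refl
    ... | no  _   | no  _   = refl
    ... | yes s≡t | no  ρ≢  = ⊥-elim (ρ≢ (cong (π ⟨$⟩ʳ_) s≡t))
    ... | no  s≢t | yes ρ≡  = ⊥-elim (s≢t (ρ-injective ρ≡))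

    anyF-relabel : (p : Fin n → Bool) → anyF (λ w → p (π ⟨$⟩ʳ w)) ≡ anyF p
    anyF-relabel p = bool-ext
      (λ any → let w , pw = anyF-witness _ any in anyF-intro p (π ⟨$⟩ʳ w) pw)
      (λ any → let w , pw = anyF-witness _ any in
               anyF-intro (λ w → p (π ⟨$⟩ʳ w)) (π ⟨$⟩ˡ w) (trans (cong p (inverseʳ π)) pw))

  reach-relabel : ∀ k s t → reach relabelled k s t ≡ reach adj k (π ⟨$⟩ʳ s) (π ⟨$⟩ʳ t)
  reach-relabel zero    s t = does-relabel s t
  reach-relabel (suc k) s t = cong₂ _∨_ (reach-relabel k s t) (begin
    anyF (λ w → reach relabelled k s w ∧ relabelled w t)
      ≡⟨ anyF-cong (λ w → cong (_∧ relabelled w t) (reach-relabel k s w)) ⟩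
    anyF (λ w → reach adj k (π ⟨$⟩ʳ s) (π ⟨$⟩ʳ w) ∧ adj (π ⟨$⟩ʳ w) (π ⟨$⟩ʳ t))
      ≡⟨ anyF-relabel (λ w → reach adj k (π ⟨$⟩ʳ s) w ∧ adj w (π ⟨$⟩ʳ t)) ⟩
    anyF (λ w → reach adj k (π ⟨$⟩ʳ s) w ∧ adj w (π ⟨$⟩ʳ t))  ∎)
    where open ≡-Reasoning

  dist-relabel : ∀ s t → dist relabelled s t ≡ dist adj (π ⟨$⟩ʳ s) (π ⟨$⟩ʳ t)
  dist-relabel s t = dist-cong (λ k → reach-relabel k s t)

  deg-relabel : ∀ v → deg relabelled v ≡ deg adj (π ⟨$⟩ʳ v)
  deg-relabel v = count-permute (adj (π ⟨$⟩ʳ v)) π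

  tree-relabel : IsTree adj → IsTree relabelled
  tree-relabel T = record
    { symmetric = λ s t → symmetric (π ⟨$⟩ʳ s) (π ⟨$⟩ʳ t)
    ; loopless  = λ s → loopless (π ⟨$⟩ʳ s)
    ; connected = λ s t → trans (reach-relabel n s t) (connected (π ⟨$⟩ʳ s) (π ⟨$⟩ʳ t))
    ; edgeCount = begin
        sumℕ (deg relabelled)               ≡⟨ sumℕ-cong deg-relabel ⟩
        sumℕ (λ v → deg adj (π ⟨$⟩ʳ v))     ≡⟨ sumℕ-permute (deg adj) π ⟩
        sumℕ (deg adj)                      ≡⟨ edgeCount ⟩
        2 * (n ∸ 1)                         ∎
    }
    where
    open IsTree T
    open ≡-Reasoning

module OrderedFieldFacts {c ℓ} (F : OrderedField c ℓ) where

  open OrderedField F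
  open CommutativeRing commutativeRing
    using (setoid; ring; +-cong; *-cong; zeroˡ; zeroʳ; distribˡ; *-identityʳ; -‿inverseʳ; commutativeSemiring)
    renaming (refl to ≈-refl; sym to ≈-sym; trans to ≈-trans; reflexive to ≈-reflexive;
              +-identityˡ to +-identityˡᶠ; +-identityʳ to +-identityʳᶠ; +-comm to +-commᶠ; *-assoc to *-assocᶠ)
  open IsTotalOrder isTotalOrder using (antisym; total; reflexive) renaming (trans to ≤-trans)
  open import Algebra.Solver.Ring.NaturalCoefficients.Default commutativeSemiring

  ≤-refl : ∀ {x} → x ≤ x
  ≤-refl = reflexive ≈-refl

  ≤-resp-≈ : ∀ {x x′ y y′} → x ≈ x′ → y ≈ y′ → x ≤ y → x′ ≤ y′
  ≤-resp-≈ x≈x′ y≈y′ x≤y = ≤-trans (reflexive (≈-sym x≈x′)) (≤-trans x≤y (reflexive y≈y′))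

  <-resp-≈ : ∀ {x x′ y y′} → x ≈ x′ → y ≈ y′ → x < y → x′ < y′
  <-resp-≈ x≈x′ y≈y′ (x≤y , x≉y) =
    ≤-resp-≈ x≈x′ y≈y′ x≤y , λ x′≈y′ → x≉y (≈-trans x≈x′ (≈-trans x′≈y′ (≈-sym y≈y′)))

  <-≤-trans : ∀ {x y z} → x < y → y ≤ z → x < z
  <-≤-trans (x≤y , x≉y) y≤z =
    ≤-trans x≤y y≤z , λ x≈z → x≉y (antisym x≤y (≤-resp-≈ ≈-refl (≈-sym x≈z) y≤z))

  +-monoʳ-≤ : ∀ {x y} z → x ≤ y → z + x ≤ z + y
  +-monoʳ-≤ z x≤y = ≤-resp-≈ (+-commᶠ _ z) (+-commᶠ _ z) (+-monoˡ-≤ z x≤y)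

  +-mono-≤ : ∀ {x y u v} → x ≤ y → u ≤ v → x + u ≤ y + v
  +-mono-≤ {y = y} {u} x≤y u≤v = ≤-trans (+-monoˡ-≤ u x≤y) (+-monoʳ-≤ y u≤v)

  +-cancelʳ-≤ : ∀ {x y} z → x + z ≤ y + z → x ≤ y
  +-cancelʳ-≤ z le = ≤-resp-≈ (cancel _) (cancel _) (+-monoˡ-≤ (- z) le)
    where
    cancel : ∀ a → (a + z) + - z ≈ a
    cancel a = ≈-trans (solve 3 (λ a z z′ → (a :+ z) :+ z′ := a :+ (z :+ z′)) ≈-refl a z (- z))
                       (≈-trans (+-cong ≈-refl (-‿inverseʳ z)) (+-identityʳᶠ a))

  +-mono-<-≤ : ∀ {x y u v} → x < y → u ≤ v → x + u < y + v
  +-mono-<-≤ {x} {y} {u} {v} (x≤y , x≉y) u≤v = +-mono-≤ x≤y u≤v , λ e →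
    x≉y (antisym x≤y (+-cancelʳ-≤ u (≤-trans (+-monoʳ-≤ y u≤v) (reflexive (≈-sym e)))))

  +-mono-≤-< : ∀ {x y u v} → x ≤ y → u < v → x + u < y + v
  +-mono-≤-< {x} {y} {u} {v} x≤y u<v =
    <-resp-≈ (+-commᶠ u x) (+-commᶠ v y) (+-mono-<-≤ u<v x≤y)

  +-cancelʳ-< : ∀ {x y} z → x + z < y + z → x < y
  +-cancelʳ-< z (le , ne) = +-cancelʳ-≤ z le , λ x≈y → ne (+-cong x≈y ≈-refl)

  difference : ∀ {x y} → x ≤ y → Σ Carrier λ z → 0# ≤ z × x + z ≈ y
  difference {x} {y} x≤y = y + - x ,
    ≤-resp-≈ (-‿inverseʳ x) ≈-refl (+-monoˡ-≤ (- x) x≤y) ,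
    (begin
      x + (y + - x)  ≈⟨ solve 3 (λ x y x′ → x :+ (y :+ x′) := y :+ (x :+ x′)) ≈-refl x y (- x) ⟩
      y + (x + - x)  ≈⟨ +-cong ≈-refl (-‿inverseʳ x) ⟩
      y + 0#         ≈⟨ +-identityʳᶠ y ⟩
      y              ∎)
    where open ≈-Reasoning setoid

  *-monoˡ-≤-nonneg : ∀ {x y} z → 0# ≤ z → x ≤ y → z * x ≤ z * y
  *-monoˡ-≤-nonneg {x} {y} z 0≤z x≤y with difference x≤y
  ... | w , 0≤w , x+w≈y = ≤-resp-≈ (+-identityʳᶠ (z * x))
    (≈-trans (≈-sym (distribˡ z x w)) (*-cong ≈-refl x+w≈y))
    (+-monoʳ-≤ (z * x) (*-nonneg 0≤z 0≤w))

  0≤1 : 0# ≤ 1#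
  0≤1 with total 0# 1#
  ... | inj₁ 0≤1 = 0≤1
  ... | inj₂ 1≤0 = ≤-resp-≈ ≈-refl minus-one-squared (*-nonneg 0≤-1 0≤-1)
    where
    open RingProperties ring using (-1*x≈-x; -‿involutive)
    0≤-1 : 0# ≤ - 1#
    0≤-1 = ≤-resp-≈ (-‿inverseʳ 1#) (+-identityˡᶠ (- 1#)) (+-monoˡ-≤ (- 1#) 1≤0)
    minus-one-squared : - 1# * - 1# ≈ 1#
    minus-one-squared = ≈-trans (-1*x≈-x (- 1#)) (-‿involutive 1#)

  product-zero : ∀ {w z} → ¬ z ≈ 0# → w * z ≈ 0# → w ≈ 0#
  product-zero {w} {z} z≉0 wz≈0 with inverse z z≉0
  ... | z⁻¹ , zz⁻¹≈1 = begin
    w                ≈⟨ *-identityʳ w ⟨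
    w * 1#           ≈⟨ *-cong ≈-refl zz⁻¹≈1 ⟨
    w * (z * z⁻¹)    ≈⟨ *-assocᶠ w z z⁻¹ ⟨
    (w * z) * z⁻¹    ≈⟨ *-cong wz≈0 ≈-refl ⟩
    0# * z⁻¹         ≈⟨ zeroˡ z⁻¹ ⟩
    0#               ∎
    where open ≈-Reasoning setoid

  *-pos : ∀ {x y} → 0# < x → 0# < y → 0# < x * y
  *-pos (0≤x , 0≉x) (0≤y , 0≉y) = *-nonneg 0≤x 0≤y ,
    λ 0≈xy → 0≉x (≈-sym (product-zero (λ y≈0 → 0≉y (≈-sym y≈0)) (≈-sym 0≈xy)))

  ι : ℕ → Carrier
  ι = fromℕ F

  ι-+ : ∀ a b → ι (a ℕ.+ b) ≈ ι a + ι b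
  ι-+ zero    b = ≈-sym (+-identityˡᶠ (ι b))
  ι-+ (suc a) b = ≈-trans (+-cong ≈-refl (ι-+ a b))
    (solve 3 (λ x y z → x :+ (y :+ z) := (x :+ y) :+ z) ≈-refl 1# (ι a) (ι b))

  ι-* : ∀ a b → ι (a ℕ.* b) ≈ ι a * ι b
  ι-* zero    b = ≈-sym (zeroˡ (ι b))
  ι-* (suc a) b = ≈-trans (ι-+ b (a ℕ.* b))
    (≈-trans (+-cong ≈-refl (ι-* a b)) (solve 2 (λ x y → y :+ x :* y := (con 1 :+ x) :* y) ≈-refl (ι a) (ι b)))

  ι-nonneg : ∀ k → 0# ≤ ι k
  ι-nonneg zero    = ≤-refl
  ι-nonneg (suc k) = ≤-resp-≈ (+-identityʳᶠ 0#) ≈-refl (+-mono-≤ 0≤1 (ι-nonneg k))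

  ι-mono : ∀ {a b} → a ℕ.≤ b → ι a ≤ ι b
  ι-mono {a} {b} a≤b = ≤-resp-≈ (+-identityʳᶠ (ι a)) ι-split (+-monoʳ-≤ (ι a) (ι-nonneg (b ℕ.∸ a)))
    where
    ι-split : ι a + ι (b ℕ.∸ a) ≈ ι b
    ι-split = ≈-trans (≈-sym (ι-+ a (b ℕ.∸ a))) (≈-reflexive (cong ι (ℕₚ.m+[n∸m]≡n a≤b)))

  -- ι a < 1 + ι a = ι (suc a) ≤ ι b.
  ι-mono-< : ∀ {a b} → a ℕ.< b → ι a < ι b
  ι-mono-< {a} a<b = <-≤-trans (<-resp-≈ (+-identityˡᶠ (ι a)) ≈-refl (+-mono-<-≤ (0≤1 , 0≉1) ≤-refl)) (ι-mono a<b)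

  *-monoˡ-<-pos : ∀ {x y} z → 0# < z → x < y → z * x < z * y
  *-monoˡ-<-pos {x} {y} z 0<z (x≤y , x≉y) with difference x≤y
  ... | w , 0≤w , x+w≈y = <-resp-≈ (+-identityʳᶠ (z * x))
    (≈-trans (≈-sym (distribˡ z x w)) (*-cong ≈-refl x+w≈y))
    (+-mono-≤-< (≤-refl {z * x}) (*-pos 0<z (0≤w , 0≉w)))
    where
    open ≈-Reasoning setoid
    0≉w : ¬ 0# ≈ w
    0≉w 0≈w = x≉y (begin
      x       ≈⟨ +-identityʳᶠ x ⟨
      x + 0#  ≈⟨ +-cong ≈-refl 0≈w ⟩
      x + w   ≈⟨ x+w≈y ⟩
      y       ∎)

  -- `Concordant a b X Y` says (a − b)(X − Y) ≥ 0: the pairs (a, b) and (X, Y)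
  -- are ordered the same way.  Exchanging two vertices of an optimal tree
  -- yields statements of this form.
  Concordant : Carrier → Carrier → Carrier → Carrier → Set ℓ
  Concordant a b X Y = a * Y + b * X ≤ a * X + b * Y

  concordant-≤ : ∀ {a b X Y} → b ≤ a → Y ≤ X → Concordant a b X Y
  concordant-≤ {a} {b} {X} {Y} b≤a Y≤X with difference b≤a | difference Y≤X
  ... | w , 0≤w , b+w≈a | z , 0≤z , Y+z≈X = ≤-resp-≈
    (≈-trans (+-identityʳᶠ _) (+-cong (*-cong b+w≈a ≈-refl) (*-cong ≈-refl Y+z≈X)))
    (≈-trans (solve 4 (λ b w Y z → ((b :+ w) :* Y :+ b :* (Y :+ z)) :+ w :* z
                                 := (b :+ w) :* (Y :+ z) :+ b :* Y) ≈-refl b w Y z)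
             (+-cong (*-cong b+w≈a Y+z≈X) ≈-refl))
    (+-monoʳ-≤ _ (*-nonneg 0≤w 0≤z))

  concordant-trans : ∀ {a b c X Y} → Concordant a b X Y → Concordant b c X Y → Concordant a c X Y
  concordant-trans {a} {b} {c} {X} {Y} ab bc = +-cancelʳ-≤ (b * X + b * Y)
    (≤-resp-≈ (shuffle a b c X Y) (≈-trans (shuffle a b c Y X) (+-cong ≈-refl (+-commᶠ (b * Y) (b * X))))
              (+-mono-≤ ab bc))
    where
    shuffle : ∀ a b c X Y → (a * Y + b * X) + (b * Y + c * X) ≈ (a * Y + c * X) + (b * X + b * Y)
    shuffle = solve 5 (λ a b c X Y → (a :* Y :+ b :* X) :+ (b :* Y :+ c :* X)
                                   := (a :* Y :+ c :* X) :+ (b :* X :+ b :* Y)) ≈-refl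

  concordant-+ : ∀ {a b X Y X′ Y′} → Concordant a b X Y → Concordant a b X′ Y′ →
    Concordant a b (X + X′) (Y + Y′)
  concordant-+ {a} {b} {X} {Y} {X′} {Y′} c c′ =
    ≤-resp-≈ (shuffle a b Y X Y′ X′) (shuffle a b X Y X′ Y′) (+-mono-≤ c c′)
    where
    shuffle : ∀ a b P Q P′ Q′ → (a * P + b * Q) + (a * P′ + b * Q′) ≈ a * (P + P′) + b * (Q + Q′)
    shuffle = solve 6 (λ a b P Q P′ Q′ → (a :* P :+ b :* Q) :+ (a :* P′ :+ b :* Q′)
                                       := a :* (P :+ P′) :+ b :* (Q :+ Q′)) ≈-refl

  concordant-scale : ∀ {a b X Y} α → 0# ≤ α → Concordant a b X Y → Concordant a b (α * X) (α * Y)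
  concordant-scale {a} {b} {X} {Y} α 0≤α c =
    ≤-resp-≈ (shuffle α a b Y X) (shuffle α a b X Y) (*-monoˡ-≤-nonneg α 0≤α c)
    where
    shuffle : ∀ α a b P Q → α * (a * P + b * Q) ≈ a * (α * P) + b * (α * Q)
    shuffle = solve 5 (λ α a b P Q → α :* (a :* P :+ b :* Q) := a :* (α :* P) :+ b :* (α :* Q)) ≈-refl

  concordant⇒≤ : ∀ {a b X Y} → Y < X → Concordant a b X Y → b ≤ a
  concordant⇒≤ {a} {b} {X} {Y} (Y≤X , Y≉X) conc with total b a
  ... | inj₁ b≤a = b≤a
  ... | inj₂ a≤b with difference a≤b | difference Y≤X
  ...   | w , 0≤w , a+w≈b | z , 0≤z , Y+z≈X = reflexive (begin
    b        ≈⟨ a+w≈b ⟨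
    a + w    ≈⟨ +-cong ≈-refl (product-zero z≉0 wz≈0) ⟩
    a + 0#   ≈⟨ +-identityʳᶠ a ⟩
    a        ∎)
    where
    open ≈-Reasoning setoid
    R : Carrier
    R = a * (Y + z) + (a + w) * Y
    wz+R≤0+R : w * z + R ≤ 0# + R
    wz+R≤0+R = ≤-resp-≈
      (≈-trans (+-cong ≈-refl (*-cong (≈-sym a+w≈b) (≈-sym Y+z≈X)))
               (solve 4 (λ a w Y z → a :* Y :+ (a :+ w) :* (Y :+ z) := w :* z :+ (a :* (Y :+ z) :+ (a :+ w) :* Y))
                        ≈-refl a w Y z))
      (≈-trans (+-cong (*-cong ≈-refl (≈-sym Y+z≈X)) (*-cong (≈-sym a+w≈b) ≈-refl)) (≈-sym (+-identityˡᶠ R)))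
      conc
    wz≈0 : w * z ≈ 0#
    wz≈0 = antisym (+-cancelʳ-≤ R wz+R≤0+R) (*-nonneg 0≤w 0≤z)
    z≉0 : ¬ z ≈ 0#
    z≉0 z≈0 = Y≉X (≈-trans (≈-sym (+-identityʳᶠ Y)) (≈-trans (+-cong ≈-refl (≈-sym z≈0)) Y+z≈X))

  concordant-three-point : ∀ {ai aj al X Y X′ Y′} α β → 0# ≤ α → 0# ≤ β →
    Concordant ai aj X Y → Concordant al aj X′ Y′ →
    α * Y + β * Y′ < α * X + β * X′ → al ≤ ai → aj ≤ ai
  concordant-three-point {ai} {aj} {al} {X} {Y} {X′} {Y′} α β 0≤α 0≤β c c′ gap al≤ai with total Y′ X′
  ... | inj₁ Y′≤X′ = concordant⇒≤ gap
    (concordant-+ (concordant-scale α 0≤α c)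
                  (concordant-scale β 0≤β (concordant-trans (concordant-≤ al≤ai Y′≤X′) c′)))
  ... | inj₂ X′≤Y′ = concordant⇒≤ αY<αX (concordant-scale α 0≤α c)
    where
    αY<αX : α * Y < α * X
    αY<αX = +-cancelʳ-< (β * Y′)
      (<-≤-trans gap (+-monoʳ-≤ (α * X) (*-monoˡ-≤-nonneg β 0≤β X′≤Y′)))

  ∑ : ∀ {n} → (Fin n → Carrier) → Carrier
  ∑ = sumF F

  ∑-cong : ∀ {n} {f g : Fin n → Carrier} → (∀ i → f i ≈ g i) → ∑ f ≈ ∑ g
  ∑-cong {zero}  f≈g = ≈-refl
  ∑-cong {suc n} f≈g = +-cong (f≈g zero) (∑-cong (f≈g ∘ suc))

  ∑-+ : ∀ {n} (f g : Fin n → Carrier) → ∑ (λ i → f i + g i) ≈ ∑ f + ∑ g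
  ∑-+ {zero}  f g = ≈-sym (+-identityʳᶠ 0#)
  ∑-+ {suc n} f g = ≈-trans (+-cong ≈-refl (∑-+ (f ∘ suc) (g ∘ suc)))
    (solve 4 (λ a b c d → (a :+ b) :+ (c :+ d) := (a :+ c) :+ (b :+ d)) ≈-refl (f zero) (g zero) _ _)

  ∑-scale : ∀ {n} k (f : Fin n → Carrier) → ∑ (λ i → k * f i) ≈ k * ∑ f
  ∑-scale {zero}  k f = ≈-sym (zeroʳ k)
  ∑-scale {suc n} k f = ≈-trans (+-cong ≈-refl (∑-scale k (f ∘ suc))) (≈-sym (distribˡ k _ _))

  ∑-mono : ∀ {n} {f g : Fin n → Carrier} → (∀ i → f i ≤ g i) → ∑ f ≤ ∑ g
  ∑-mono {zero}  f≤g = ≤-refl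
  ∑-mono {suc n} f≤g = +-mono-≤ (f≤g zero) (∑-mono (f≤g ∘ suc))

  ∑-mono-< : ∀ {n} {f g : Fin n → Carrier} → (∀ i → f i ≤ g i) → ∀ k → f k < g k → ∑ f < ∑ g
  ∑-mono-< f≤g zero    fk<gk = +-mono-<-≤ fk<gk (∑-mono (f≤g ∘ suc))
  ∑-mono-< f≤g (suc k) fk<gk = +-mono-≤-< (f≤g zero) (∑-mono-< (f≤g ∘ suc) k fk<gk)

  without : ∀ {n} → Fin n → (Fin n → Carrier) → Fin n → Carrier
  without x f w = if does (w ≟ x) then 0# else f w

  ∑-remove : ∀ {n} (x : Fin n) (f : Fin n → Carrier) → ∑ f ≈ f x + ∑ (without x f)
  ∑-remove zero    f = +-cong ≈-refl (≈-sym (+-identityˡᶠ _))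
  ∑-remove (suc x) f = ≈-trans (+-cong ≈-refl (∑-remove x (f ∘ suc)))
    (solve 3 (λ a b c → a :+ (b :+ c) := b :+ (a :+ c)) ≈-refl (f zero) (f (suc x)) _)

  ∑-combine : ∀ {n} (μ : Fin n → Carrier) A B (f g : Fin n → ℕ) →
    ι A * ∑ (λ w → μ w * ι (f w)) + ι B * ∑ (λ w → μ w * ι (g w)) ≈ ∑ (λ w → μ w * ι (A ℕ.* f w ℕ.+ B ℕ.* g w))
  ∑-combine μ A B f g = ≈-sym (≈-trans (∑-cong pointwise)
    (≈-trans (∑-+ (λ w → ι A * (μ w * ι (f w))) (λ w → ι B * (μ w * ι (g w))))
             (+-cong (∑-scale (ι A) (λ w → μ w * ι (f w))) (∑-scale (ι B) (λ w → μ w * ι (g w))))))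
    where
    pointwise : ∀ w → μ w * ι (A ℕ.* f w ℕ.+ B ℕ.* g w) ≈ ι A * (μ w * ι (f w)) + ι B * (μ w * ι (g w))
    pointwise w = ≈-trans
      (*-cong ≈-refl (≈-trans (ι-+ (A ℕ.* f w) (B ℕ.* g w)) (+-cong (ι-* A (f w)) (ι-* B (g w)))))
      (solve 5 (λ m a x b y → m :* (a :* x :+ b :* y) := a :* (m :* x) :+ b :* (m :* y)) ≈-refl
             (μ w) (ι A) (ι (f w)) (ι B) (ι (g w)))

  ∑-weighted-< : ∀ {n} (μ : Fin n → Carrier) → (∀ w → 0# < μ w) → {f g : Fin n → ℕ} →
    (∀ w → f w ℕ.≤ g w) → ∀ k → f k ℕ.< g k → ∑ (λ w → μ w * ι (f w)) < ∑ (λ w → μ w * ι (g w))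
  ∑-weighted-< μ μ>0 f≤g k fk<gk =
    ∑-mono-< (λ w → *-monoˡ-≤-nonneg (μ w) (proj₁ (μ>0 w)) (ι-mono (f≤g w))) k
             (*-monoˡ-<-pos (μ k) (μ>0 k) (ι-mono-< fk<gk))

-- Only the terms linking {x, y} to the remaining vertices change, which makes
-- Φ(D ∘ σ) ≤ Φ(D) (σ the transposition of x and y) a concordance between the
-- weights of x, y and their transmissions to the remaining vertices.
module Exchange {c ℓ} (F : OrderedField c ℓ) {n : ℕ} (μ : Fin n → OrderedField.Carrier F)
                (x y : Fin n) (x≢y : x ≢ y) where

  open OrderedField F
  open OrderedFieldFacts F
  open CommutativeRing commutativeRing using (setoid; +-cong; *-cong; commutativeSemiring)
    renaming (refl to ≈-refl; sym to ≈-sym; trans to ≈-trans; reflexive to ≈-reflexive;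
              +-identityʳ to +-identityʳᶠ)
  open import Algebra.Solver.Ring.NaturalCoefficients.Default commutativeSemiring

  σ : Fin n → Fin n
  σ = PC.transpose x y

  σ-x : σ x ≡ y
  σ-x rewrite dec-true (x ≟ x) refl = refl

  σ-y : σ y ≡ x
  σ-y rewrite dec-false (y ≟ x) (x≢y ∘ sym) | dec-true (y ≟ y) refl = refl

  σ-other : ∀ {w} → ¬ w ≡ x → ¬ w ≡ y → σ w ≡ w
  σ-other {w} w≢x w≢y rewrite dec-false (w ≟ x) w≢x | dec-false (w ≟ y) w≢y = refl

  σ-invariant : ∀ {a} {A : Set a} (f : Fin n → A) → f x ≡ f y → ∀ w → f (σ w) ≡ f w
  σ-invariant f fx≡fy w = by-cases (w ≟ x) (w ≟ y)
    where
    by-cases : Dec (w ≡ x) → Dec (w ≡ y) → f (σ w) ≡ f w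
    by-cases (yes refl) _          = trans (cong f σ-x) (sym fx≡fy)
    by-cases (no _)     (yes refl) = trans (cong f σ-y) fx≡fy
    by-cases (no w≢x)   (no w≢y)   = cong f (σ-other w≢x w≢y)

  others : (Fin n → Carrier) → Fin n → Carrier
  others f w = if does (w ≟ y) then 0# else (if does (w ≟ x) then 0# else f w)

  othersℕ : Fin n → ℕ → ℕ
  othersℕ w k = if does (w ≟ y) then 0 else (if does (w ≟ x) then 0 else k)

  others-cong : ∀ {f g} → (∀ w → ¬ w ≡ x → ¬ w ≡ y → f w ≈ g w) → ∀ w → others f w ≈ others g w
  others-cong f≈g w with w ≟ y | w ≟ x
  ... | yes _   | _       = ≈-refl
  ... | no  _   | yes _   = ≈-refl
  ... | no  w≢y | no  w≢x = f≈g w w≢x w≢y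

  othersℕ-cong : ∀ {k k′ : Fin n → ℕ} → (∀ w → ¬ w ≡ x → ¬ w ≡ y → k w ≡ k′ w) →
    ∀ w → othersℕ w (k w) ≡ othersℕ w (k′ w)
  othersℕ-cong k≡k′ w with w ≟ y | w ≟ x
  ... | yes _   | _       = refl
  ... | no  _   | yes _   = refl
  ... | no  w≢y | no  w≢x = k≡k′ w w≢x w≢y

  others-+ : ∀ f g w → others (λ v → f v + g v) w ≈ others f w + others g w
  others-+ f g w with does (w ≟ y) | does (w ≟ x)
  ... | true  | _     = ≈-sym (+-identityʳᶠ 0#)
  ... | false | true  = ≈-sym (+-identityʳᶠ 0#)
  ... | false | false = ≈-refl

  ∑-split : ∀ f → ∑ f ≈ f x + (f y + ∑ (others f))
  ∑-split f = ≈-trans (∑-remove x f) (+-cong ≈-refl (≈-trans (∑-remove y (without x f))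
    (+-cong (≈-reflexive (cong (λ b → if b then 0# else f y) (dec-false (y ≟ x) (x≢y ∘ sym)))) ≈-refl)))

  Φ : (Fin n → Fin n → ℕ) → Carrier
  Φ D = ∑ (λ u → ∑ (λ v → μ u * μ v * ι (D u v)))

  transmission : (Fin n → Fin n → ℕ) → Fin n → Carrier
  transmission D z = ∑ (λ w → μ w * ι (othersℕ w (D z w ℕ.+ D w z)))

  private
    module _ (D : Fin n → Fin n → ℕ) where
      term : Fin n → Fin n → Carrier
      term u v = μ u * μ v * ι (D u v)

      corner inner : Carrier
      corner = (term x x + term x y) + (term y x + term y y)
      inner  = ∑ (others (λ u → ∑ (others (term u))))

      row colx coly cross : Fin n → Carrier
      row u   = ∑ (term u)
      colx v  = term v x
      coly v  = term v y
      cross w = (term x w + term y w) + (term w x + term w y)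

      others-row : ∀ u → others row u ≈ others colx u + (others coly u + others (λ v → ∑ (others (term v))) u)
      others-row u = begin
        others row u
          ≈⟨ others-cong (λ v _ _ → ∑-split (term v)) u ⟩
        others (λ v → colx v + (coly v + ∑ (others (term v)))) u
          ≈⟨ others-+ colx (λ v → coly v + ∑ (others (term v))) u ⟩
        others colx u + others (λ v → coly v + ∑ (others (term v))) u
          ≈⟨ +-cong ≈-refl (others-+ coly (λ v → ∑ (others (term v))) u) ⟩
        others colx u + (others coly u + others (λ v → ∑ (others (term v))) u)  ∎
        where open ≈-Reasoning setoid

      ∑-others-row : ∑ (others row) ≈ ∑ (others colx) + (∑ (others coly) + inner)
      ∑-others-row = ≈-trans (∑-cong others-row)
        (≈-trans (∑-+ (others colx) (λ u → others coly u + others inner-row u))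
                 (+-cong ≈-refl (∑-+ (others coly) (others inner-row))))
        where
        inner-row : Fin n → Carrier
        inner-row v = ∑ (others (term v))

      ∑-others-cross : ∑ (others cross) ≈
        (∑ (others (term x)) + ∑ (others (term y))) + (∑ (others colx) + ∑ (others coly))
      ∑-others-cross = ≈-trans
        (∑-cong (λ w → ≈-trans (others-+ (λ v → term x v + term y v) (λ v → colx v + coly v) w)
                               (+-cong (others-+ (term x) (term y) w) (others-+ colx coly w))))
        (≈-trans (∑-+ (λ w → others (term x) w + others (term y) w) (λ w → others colx w + others coly w))
                 (+-cong (∑-+ (others (term x)) (others (term y))) (∑-+ (others colx) (others coly))))

      Φ-split : Φ D ≈ corner + (∑ (others cross) + inner)
      Φ-split = begin
        ∑ row
          ≈⟨ ∑-split row ⟩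
        row x + (row y + ∑ (others row))
          ≈⟨ +-cong (∑-split (term x)) (+-cong (∑-split (term y)) ∑-others-row) ⟩
        (term x x + (term x y + ∑ (others (term x)))) +
        ((term y x + (term y y + ∑ (others (term y)))) + (∑ (others colx) + (∑ (others coly) + inner)))
          ≈⟨ solve 9 (λ xx xy yx yy ox oy cx cy c →
               (xx :+ (xy :+ ox)) :+ ((yx :+ (yy :+ oy)) :+ (cx :+ (cy :+ c)))
               := ((xx :+ xy) :+ (yx :+ yy)) :+ (((ox :+ oy) :+ (cx :+ cy)) :+ c))
               ≈-refl (term x x) (term x y) (term y x) (term y y)
                      (∑ (others (term x))) (∑ (others (term y))) (∑ (others colx)) (∑ (others coly)) inner ⟩
        corner + (((∑ (others (term x)) + ∑ (others (term y))) + (∑ (others colx) + ∑ (others coly))) + inner)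
          ≈⟨ +-cong ≈-refl (+-cong (≈-sym ∑-others-cross) ≈-refl) ⟩
        corner + (∑ (others cross) + inner)  ∎
        where open ≈-Reasoning setoid

      linking : ∑ (others cross) ≈ μ x * transmission D x + μ y * transmission D y
      linking = ≈-trans (∑-cong regroup)
        (≈-trans (∑-+ (λ w → μ x * tx w) (λ w → μ y * ty w)) (+-cong (∑-scale (μ x) tx) (∑-scale (μ y) ty)))
        where
        vanishing : ∀ a b m → 0# ≈ a * (m * 0#) + b * (m * 0#)
        vanishing = solve 3 (λ a b m → con 0 := a :* (m :* con 0) :+ b :* (m :* con 0)) ≈-refl
        tx ty : Fin n → Carrier
        tx w = μ w * ι (othersℕ w (D x w ℕ.+ D w x))
        ty w = μ w * ι (othersℕ w (D y w ℕ.+ D w y))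
        regroup : ∀ w → others cross w ≈
          μ x * (μ w * ι (othersℕ w (D x w ℕ.+ D w x))) + μ y * (μ w * ι (othersℕ w (D y w ℕ.+ D w y)))
        regroup w with does (w ≟ y) | does (w ≟ x)
        ... | true  | _     = vanishing (μ x) (μ y) (μ w)
        ... | false | true  = vanishing (μ x) (μ y) (μ w)
        ... | false | false = ≈-trans
          (solve 7 (λ a b m p q r s → (a :* m :* p :+ b :* m :* q) :+ (m :* a :* r :+ m :* b :* s)
                                    := a :* (m :* (p :+ r)) :+ b :* (m :* (q :+ s)))
                   ≈-refl (μ x) (μ y) (μ w) (ι (D x w)) (ι (D y w)) (ι (D w x)) (ι (D w y)))
          (+-cong (*-cong ≈-refl (*-cong ≈-refl (≈-sym (ι-+ (D x w) (D w x)))))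
                  (*-cong ≈-refl (*-cong ≈-refl (≈-sym (ι-+ (D y w) (D w y))))))

  exchange : ∀ D → D x x ≡ 0 → D y y ≡ 0 → Φ (λ u v → D (σ u) (σ v)) ≤ Φ D →
    Concordant (μ x) (μ y) (transmission D x) (transmission D y)
  exchange D Dxx Dyy Φσ≤Φ = +-cancelʳ-≤ (corner D + inner D) (≤-resp-≈ expandσ expand Φσ≤Φ)
    where
    open ≈-Reasoning setoid
    Dσ : Fin n → Fin n → ℕ
    Dσ u v = D (σ u) (σ v)

    T : Fin n → Carrier
    T = transmission D

    rearrange : ∀ P L C → P + (L + C) ≈ L + (P + C)
    rearrange = solve 3 (λ P L C → P :+ (L :+ C) := L :+ (P :+ C)) ≈-refl

    corner-swap : corner Dσ ≈ corner D
    corner-swap rewrite σ-x | σ-y | Dxx | Dyy =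
      solve 4 (λ a b p q → a :* a :* con 0 :+ a :* b :* q :+ (b :* a :* p :+ b :* b :* con 0)
                         := a :* a :* con 0 :+ a :* b :* p :+ (b :* a :* q :+ b :* b :* con 0))
              ≈-refl (μ x) (μ y) (ι (D x y)) (ι (D y x))

    transmission-swap : ∀ {z z′} → σ z ≡ z′ → transmission Dσ z ≈ T z′
    transmission-swap σz≡z′ = ∑-cong (λ w → *-cong ≈-refl (≈-reflexive (cong ι
      (othersℕ-cong (λ w w≢x w≢y → cong₂ ℕ._+_
        (cong₂ D σz≡z′ (σ-other w≢x w≢y)) (cong₂ D (σ-other w≢x w≢y) σz≡z′)) w))))

    inner-swap : inner Dσ ≈ inner D
    inner-swap = ∑-cong (others-cong (λ u u≢x u≢y → ∑-cong (others-cong (λ v v≢x v≢y →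
      ≈-reflexive (cong₂ (λ a b → μ u * μ v * ι (D a b)) (σ-other u≢x u≢y) (σ-other v≢x v≢y))))))

    expandσ : Φ Dσ ≈ (μ x * T y + μ y * T x) + (corner D + inner D)
    expandσ = begin
      Φ Dσ
        ≈⟨ Φ-split Dσ ⟩
      corner Dσ + (∑ (others (cross Dσ)) + inner Dσ)
        ≈⟨ +-cong corner-swap (+-cong (≈-trans (linking Dσ)
             (+-cong (*-cong ≈-refl (transmission-swap {x} σ-x)) (*-cong ≈-refl (transmission-swap {y} σ-y)))) inner-swap) ⟩
      corner D + ((μ x * T y + μ y * T x) + inner D)
        ≈⟨ rearrange _ _ _ ⟩
      (μ x * T y + μ y * T x) + (corner D + inner D)  ∎

    expand : Φ D ≈ (μ x * T x + μ y * T y) + (corner D + inner D)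
    expand = ≈-trans (Φ-split D) (≈-trans (+-cong ≈-refl (+-cong (linking D) ≈-refl)) (rearrange _ _ _))

module Caterpillar {n : ℕ} (adj : Adj n) (T : IsTree adj) {q : ℕ} (b : Fin q → Fin n)
                   (cat : IsCaterpillarBackbone adj q b) where

  open import Data.Nat using (_+_; _*_; _≤_; _<_)
  open ℕₚ hiding (_≟_)
  open IsTree T
  open IsCaterpillarBackbone cat
  open Walks adj

  adj-sym : ∀ {s t} → adj s t ≡ true → adj t s ≡ true
  adj-sym {s} {t} = trans (symmetric t s)

  pendent-neighbour : ∀ {w} → Pendent adj w → ∃ λ v → adj w v ≡ true
  pendent-neighbour {w} = count-one-witness (adj w)

  pendent-unique : ∀ {w s t} → Pendent adj w → adj w s ≡ true → adj w t ≡ true → s ≡ t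
  pendent-unique {w} p = count-one-unique (adj w) p

  OnBackbone : Fin n → Set
  OnBackbone w = ∃ λ m → b m ≡ w

  onBackbone? : ∀ w → Dec (OnBackbone w)
  onBackbone? w = any? (λ m → b m ≟ w)

  off-backbone⇒pendent : ∀ {w} → ¬ OnBackbone w → Pendent adj w
  off-backbone⇒pendent {w} off with deg adj w ℕ.≟ 1
  ... | yes p = p
  ... | no ¬p = ⊥-elim (off (internal⇒on w ¬p))

  pendent⇒off-backbone : ∀ {w} → Pendent adj w → ¬ OnBackbone w
  pendent⇒off-backbone p (m , refl) = on⇒internal m p

  first : Fin q
  first = fromℕ< nonempty

  root : Fin n
  root = b first

  -- No edge joins two vertices off the backbone: being both pendent, its ends
  -- would form a component of their own, missing the root.
  no-edge-off-backbone : ∀ {w v} → ¬ OnBackbone w → ¬ OnBackbone v → adj w v ≡ true → ⊥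
  no-edge-off-backbone {w} {v} off-w off-v awv =
    root∉pair (reach-closed pair closed pair-w (Reach n w root ∋ walk (connected w root)))
    where
    pair : Fin n → Bool
    pair z = does (z ≟ w) ∨ does (z ≟ v)
    pair-w : pair w ≡ true
    pair-w rewrite dec-true (w ≟ w) refl = refl
    pair-v : pair v ≡ true
    pair-v rewrite dec-true (v ≟ v) refl = ∨-zeroʳ _
    -- (s outside the pair is excluded by `pair s ≡ true`)
    closed : ∀ s t → pair s ≡ true → adj s t ≡ true → pair t ≡ true
    closed s t ps ast with s ≟ w | s ≟ v
    ... | yes refl | _        =
      subst (λ z → pair z ≡ true) (pendent-unique (off-backbone⇒pendent off-w) awv ast) pair-v
    ... | no _     | yes refl =
      subst (λ z → pair z ≡ true) (pendent-unique (off-backbone⇒pendent off-v) (adj-sym awv) ast) pair-w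
    root∉pair : pair root ≡ true → ⊥
    root∉pair with root ≟ w | root ≟ v
    ... | yes r≡w | _       = λ _ → off-w (first , r≡w)
    ... | no _    | yes r≡v = λ _ → off-v (first , r≡v)
    ... | no _    | no _    = λ ()

  data Place (w : Fin n) : Set where
    spine : (m : Fin q) → b m ≡ w → Place w
    leaf  : (m : Fin q) → ¬ OnBackbone w → adj w (b m) ≡ true → Place w

  place : ∀ w → Place w
  place w with onBackbone? w
  ... | yes (m , bm≡w) = spine m bm≡w
  ... | no off with pendent-neighbour (off-backbone⇒pendent off)
  ...   | v , awv with onBackbone? v
  ...     | yes (m , bm≡v) = leaf m off (subst (λ z → adj w z ≡ true) (sym bm≡v) awv)
  ...     | no off-v       = ⊥-elim (no-edge-off-backbone off off-v awv)

  anchor : ∀ {w} → Place w → Fin q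
  anchor (spine m _)  = m
  anchor (leaf m _ _) = m

  -- 1 on the backbone, 2 for a pendent vertex: the distance to a far-away
  -- pendent vertex exceeds the backbone distance by this amount.
  height : ∀ {w} → Place w → ℕ
  height (spine _ _)  = 1
  height (leaf _ _ _) = 2

  place-spine : ∀ m → anchor (place (b m)) ≡ m × height (place (b m)) ≡ 1
  place-spine m with place (b m)
  ... | spine m′ e   = injective e , refl
  ... | leaf _ off _ = ⊥-elim (off (m , refl))

  place-leaf : ∀ {w m} → Pendent adj w → adj w (b m) ≡ true → anchor (place w) ≡ m × height (place w) ≡ 2
  place-leaf {w} p a with place w
  ... | spine m′ e   = ⊥-elim (pendent⇒off-backbone p (m′ , e))
  ... | leaf m′ _ a′ = injective (pendent-unique p a′ a) , refl

  -- The predecessor of a backbone position (the first one is its own predecessor).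
  previous : Fin q → Fin q
  previous m = fromℕ< (≤-<-trans (m∸n≤m (toℕ m) 1) (toℕ<n m))

  toℕ-previous : ∀ m → toℕ (previous m) ≡ toℕ m ∸ 1
  toℕ-previous m = toℕ-fromℕ< _

  previous-suc : ∀ m → b m ≢ root → toℕ m ≡ suc (toℕ (previous m))
  previous-suc m bm≢root =
    trans (sym (suc-pred (toℕ m) {{ℕ.>-nonZero (n≢0⇒n>0 toℕm≢0)}})) (cong suc (sym (toℕ-previous m)))
    where
    toℕm≢0 : toℕ m ≢ 0
    toℕm≢0 e = bm≢root (cong b (toℕ-injective (trans e (sym (toℕ-fromℕ< nonempty)))))

  parentAt : ∀ {w} → Place w → Fin n
  parentAt (spine m _)  = b (previous m)
  parentAt (leaf m _ _) = b m

  parent : Fin n → Fin n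
  parent w = parentAt (place w)

  parent-spine : ∀ m → parent (b m) ≡ b (previous m)
  parent-spine m with place (b m)
  ... | spine m′ e   = cong (b ∘ previous) (injective e)
  ... | leaf _ off _ = ⊥-elim (off (m , refl))

  parent-adj : ∀ w → w ≢ root → adj w (parent w) ≡ true
  parent-adj w w≢root with place w
  ... | spine m refl = adj-sym (consecutive (previous m) m (previous-suc m w≢root))
  ... | leaf m _ a   = a

  parent-not-mutual : ∀ {v w} → v ≢ root → w ≡ parent v → v ≡ parent w → ⊥
  parent-not-mutual {v} v≢root w≡pv v≡pw with place v
  ... | spine m refl = <-irrefl (sym m≡pp) (begin-strict
          toℕ (previous (previous m))      ≡⟨ toℕ-previous (previous m) ⟩
          toℕ (previous m) ∸ 1             ≤⟨ m∸n≤m _ 1 ⟩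
          toℕ (previous m)                 <⟨ n<1+n _ ⟩
          suc (toℕ (previous m))           ≡⟨ previous-suc m v≢root ⟨
          toℕ m                            ∎)
    where
    open ≤-Reasoning
    m≡pp : toℕ m ≡ toℕ (previous (previous m))
    m≡pp = cong toℕ (injective (trans v≡pw (trans (cong parent w≡pv) (parent-spine (previous m)))))
  ... | leaf m off _ = off (previous m , sym (trans v≡pw (trans (cong parent w≡pv) (parent-spine m))))

  parentEdge : Fin n → Fin n → ℕ
  parentEdge v w = indicator (not (does (v ≟ root)) ∧ does (w ≟ parent v))

  parentEdge-view : ∀ v w → parentEdge v w ≡ 0 ⊎ (parentEdge v w ≡ 1 × v ≢ root × w ≡ parent v)
  parentEdge-view v w with v ≟ root | w ≟ parent v
  ... | yes _     | _         = inj₁ refl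
  ... | no _      | no _      = inj₁ refl
  ... | no v≢root | yes w≡pv  = inj₂ (refl , v≢root , w≡pv)

  -- The n − 1 parent edges, counted in both directions, already use up the
  -- 2(n − 1) adjacency entries of the tree.
  parentEdge-total : sumℕ (λ v → sumℕ (λ w → parentEdge v w + parentEdge w v)) ≡ 2 * (n ∸ 1)
  parentEdge-total = begin
    sumℕ (λ v → sumℕ (λ w → parentEdge v w + parentEdge w v))
      ≡⟨ sumℕ-cong (λ v → sumℕ-+ (parentEdge v) (λ w → parentEdge w v)) ⟩
    sumℕ (λ v → sumℕ (parentEdge v) + sumℕ (λ w → parentEdge w v))
      ≡⟨ sumℕ-+ (λ v → sumℕ (parentEdge v)) (λ v → sumℕ (λ w → parentEdge w v)) ⟩
    sumℕ (λ v → sumℕ (parentEdge v)) + sumℕ (λ v → sumℕ (λ w → parentEdge w v))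
      ≡⟨ cong (sumℕ (λ v → sumℕ (parentEdge v)) +_) (sumℕ-comm parentEdge) ⟨
    sumℕ (λ v → sumℕ (parentEdge v)) + sumℕ (λ v → sumℕ (parentEdge v))
      ≡⟨ cong₂ _+_ rows rows ⟩
    (n ∸ 1) + (n ∸ 1)
      ≡⟨ cong ((n ∸ 1) +_) (+-identityʳ (n ∸ 1)) ⟨
    2 * (n ∸ 1)  ∎
    where
    open ≡-Reasoning
    row : ∀ v → sumℕ (parentEdge v) ≡ indicator (not (does (v ≟ root)))
    row v with does (v ≟ root)
    ... | true  = sumℕ-zeros {n}
    ... | false = sumℕ-delta (parent v)
    rows : sumℕ (λ v → sumℕ (parentEdge v)) ≡ n ∸ 1
    rows = trans (sumℕ-cong row) (sumℕ-all-but root)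

  parentEdge-≤-adj : ∀ v w → parentEdge v w + parentEdge w v ≤ indicator (adj v w)
  parentEdge-≤-adj v w with parentEdge-view v w | parentEdge-view w v
  ... | inj₁ e₁ | inj₁ e₂ rewrite e₁ | e₂ = z≤n
  ... | inj₂ (e₁ , v≢root , refl) | inj₁ e₂ rewrite e₁ | e₂ | parent-adj v v≢root = ≤-refl
  ... | inj₁ e₁ | inj₂ (e₂ , w≢root , refl) rewrite e₁ | e₂ | adj-sym (parent-adj w w≢root) = ≤-refl
  ... | inj₂ (_ , v≢root , w≡pv) | inj₂ (_ , _ , v≡pw) = ⊥-elim (parent-not-mutual v≢root w≡pv v≡pw)

  parentEdge-exact : ∀ v w → parentEdge v w + parentEdge w v ≡ indicator (adj v w)
  parentEdge-exact v = sumℕ-tight (parentEdge-≤-adj v) (≤-reflexive (sym (rows-exact v)))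
    where
    adjacency : sumℕ (λ v → sumℕ (λ w → indicator (adj v w))) ≡ 2 * (n ∸ 1)
    adjacency = trans (sumℕ-cong (λ v → sym (count≡sumℕ (adj v)))) edgeCount
    rows-exact : ∀ v → sumℕ (λ w → parentEdge v w + parentEdge w v) ≡ sumℕ (λ w → indicator (adj v w))
    rows-exact = sumℕ-tight (λ v → sumℕ-mono (parentEdge-≤-adj v))
                            (≤-reflexive (trans adjacency (sym parentEdge-total)))

  edge⇒parent : ∀ {v w} → adj v w ≡ true → (v ≢ root × w ≡ parent v) ⊎ (w ≢ root × v ≡ parent w)
  edge⇒parent {v} {w} avw with parentEdge-view v w | parentEdge-view w v | parentEdge-exact v w
  ... | inj₂ (_ , v≢root , w≡pv) | _                          | _ = inj₁ (v≢root , w≡pv)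
  ... | inj₁ _                   | inj₂ (_ , w≢root , v≡pw)  | _ = inj₂ (w≢root , v≡pw)
  ... | inj₁ e₁                  | inj₁ e₂                    | exact rewrite e₁ | e₂ | avw = ⊥-elim (0≢1+n exact)

  backbone-edge : ∀ {i j} → adj (b i) (b j) ≡ true → toℕ i ≡ suc (toℕ j) ⊎ toℕ j ≡ suc (toℕ i)
  backbone-edge {i} {j} a with edge⇒parent a
  ... | inj₁ (bi≢root , bj≡pbi) = inj₁ (trans (previous-suc i bi≢root)
          (cong (suc ∘ toℕ) (sym (injective (trans bj≡pbi (parent-spine i))))))
  ... | inj₂ (bj≢root , bi≡pbj) = inj₂ (trans (previous-suc j bj≢root)
          (cong (suc ∘ toℕ) (sym (injective (trans bi≡pbj (parent-spine j))))))

  backbone-walk-up : ∀ d (i j : Fin q) → toℕ j ≡ toℕ i + d → Reach d (b i) (b j)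
  backbone-walk-up zero    i j e = subst (λ z → Reach 0 (b i) (b z))
    (toℕ-injective (sym (trans e (+-identityʳ (toℕ i))))) (reach-refl (b i))
  backbone-walk-up (suc d) i j e = reach-snoc (backbone-walk-up d i j′ (toℕ-fromℕ< j′<q))
    (consecutive j′ j (trans e (trans (+-suc (toℕ i) d) (cong suc (sym (toℕ-fromℕ< j′<q))))))
    where
    j′<q : toℕ i + d < q
    j′<q = ≤-trans (≤-reflexive (sym (trans e (+-suc (toℕ i) d)))) (<⇒≤ (toℕ<n j))
    j′ : Fin q
    j′ = fromℕ< j′<q

  backbone-walk : ∀ i j → Reach ∣ toℕ i - toℕ j ∣ (b i) (b j)
  backbone-walk i j with ≤-total (toℕ i) (toℕ j)
  ... | inj₁ i≤j rewrite m≤n⇒∣m-n∣≡n∸m i≤j =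
    backbone-walk-up (toℕ j ∸ toℕ i) i j (sym (m+[n∸m]≡n i≤j))
  ... | inj₂ j≤i rewrite m≤n⇒∣n-m∣≡n∸m j≤i =
    reach-sym symmetric (backbone-walk-up (toℕ i ∸ toℕ j) j i (sym (m+[n∸m]≡n j≤i)))

  height-≤2 : ∀ {w} (p : Place w) → height p ≤ 2
  height-≤2 (spine _ _)  = s≤s z≤n
  height-≤2 (leaf _ _ _) = ≤-refl

  module FromLeaf (u : Fin n) (k : Fin q) (u-pendent : Pendent adj u) (u-k : adj u (b k) ≡ true) where

    gapAt : ∀ {w} → Place w → ℕ
    gapAt {w} p = if does (w ≟ u) then 0 else ∣ toℕ (anchor p) - toℕ k ∣ + height p

    gap : Fin n → ℕ
    gap w = gapAt (place w)

    private
      u-off : ¬ OnBackbone u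
      u-off = pendent⇒off-backbone u-pendent

      spine≢u : ∀ m → does (b m ≟ u) ≡ false
      spine≢u m = dec-false (b m ≟ u) (λ e → u-off (m , e))

      ∣n-1+n∣≡1 : ∀ y → ∣ y - suc y ∣ ≡ 1
      ∣n-1+n∣≡1 zero    = refl
      ∣n-1+n∣≡1 (suc y) = ∣n-1+n∣≡1 y

      neighbour-gap : ∀ x y z → x ≡ suc y ⊎ y ≡ suc x → ∣ y - z ∣ ≤ suc ∣ x - z ∣
      neighbour-gap x y z adjacent = ≤-trans (∣-∣-triangle y x z) (+-monoˡ-≤ ∣ x - z ∣ (≤-reflexive (one adjacent)))
        where
        one : x ≡ suc y ⊎ y ≡ suc x → ∣ y - x ∣ ≡ 1
        one (inj₁ refl) = ∣n-1+n∣≡1 y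
        one (inj₂ refl) = trans (∣-∣-comm (suc x) x) (∣n-1+n∣≡1 x)

    gap-self : gap u ≡ 0
    gap-self rewrite dec-true (u ≟ u) refl = refl

    gap-other : ∀ {w} → w ≢ u → gap w ≡ ∣ toℕ (anchor (place w)) - toℕ k ∣ + height (place w)
    gap-other {w} w≢u rewrite dec-false (w ≟ u) w≢u = refl

    gap-lipschitz : ∀ s t → adj s t ≡ true → gap t ≤ suc (gap s)
    gap-lipschitz s t a = lip (place s) (place t)
      where
      lip : (ps : Place s) (pt : Place t) → gapAt pt ≤ suc (gapAt ps)
      lip (spine i refl) (spine j refl) rewrite spine≢u i | spine≢u j =
        +-monoˡ-≤ 1 (neighbour-gap (toℕ i) (toℕ j) (toℕ k) (backbone-edge a))
      lip (spine i refl) (leaf j off-t at) with t ≟ u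
      ... | yes _ = z≤n
      ... | no _ rewrite spine≢u i
                       | injective (pendent-unique (off-backbone⇒pendent off-t) at (adj-sym a)) =
        ≤-reflexive (+-suc _ 1)
      lip (leaf i off-s as) (spine j refl) with s ≟ u
      ... | yes refl rewrite spine≢u j
                           | injective (pendent-unique u-pendent a u-k) | ∣n-n∣≡0 (toℕ k) = ≤-refl
      ... | no _     rewrite spine≢u j
                           | injective (pendent-unique (off-backbone⇒pendent off-s) as a) =
        ≤-trans (+-monoʳ-≤ _ (s≤s (z≤n {1}))) (n≤1+n _)
      lip (leaf _ off-s _) (leaf _ off-t _) = ⊥-elim (no-edge-off-backbone off-s off-t a)

    -- There are at least q + 1 vertices: the backbone and u.
    q<n : q < n
    q<n = injective⇒≤ {f = backbone-and-u} inj
      where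
      backbone-and-u : Fin (suc q) → Fin n
      backbone-and-u zero    = u
      backbone-and-u (suc m) = b m
      inj : ∀ {i j} → backbone-and-u i ≡ backbone-and-u j → i ≡ j
      inj {zero}  {zero}  _ = refl
      inj {zero}  {suc j} e = ⊥-elim (u-off (j , sym e))
      inj {suc i} {zero}  e = ⊥-elim (u-off (i , e))
      inj {suc i} {suc j} e = cong suc (injective e)

    gap-bound : ∀ w → gap w ≤ n
    gap-bound w with does (w ≟ u)
    ... | true  = z≤n
    ... | false = begin
      ∣ toℕ (anchor (place w)) - toℕ k ∣ + height (place w)  ≤⟨ +-monoʳ-≤ _ (height-≤2 (place w)) ⟩
      ∣ toℕ (anchor (place w)) - toℕ k ∣ + 2                  ≡⟨ +-comm _ 2 ⟩
      suc (suc ∣ toℕ (anchor (place w)) - toℕ k ∣)            ≤⟨ s≤s (∣-∣<q (anchor (place w))) ⟩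
      suc q                                                   ≤⟨ q<n ⟩
      n                                                       ∎
      where
      open ≤-Reasoning
      ∣-∣<q : ∀ m → ∣ toℕ m - toℕ k ∣ < q
      ∣-∣<q m = ≤-<-trans (∣m-n∣≤m⊔n (toℕ m) (toℕ k)) (⊔-lub (toℕ<n m) (toℕ<n k))

    gap-reach : ∀ w → Reach (gap w) u w
    gap-reach w = reachAt (place w)
      where
      to-backbone : ∀ m → Reach (1 + ∣ toℕ k - toℕ m ∣) u (b m)
      to-backbone m = reach-trans (reach-edge u-k) (backbone-walk k m)
      reachAt : (p : Place w) → Reach (gapAt p) u w
      reachAt (spine m refl) rewrite spine≢u m =
        reach-weaken (≤-reflexive (trans (+-comm 1 _) (cong (_+ 1) (∣-∣-comm (toℕ k) (toℕ m))))) (to-backbone m)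
      reachAt (leaf m _ a) with w ≟ u
      ... | yes refl = reach-refl u
      ... | no _     = reach-weaken
        (≤-reflexive (trans (+-comm (1 + ∣ toℕ k - toℕ m ∣) 1)
                             (trans (+-comm 2 _) (cong (_+ 2) (∣-∣-comm (toℕ k) (toℕ m))))))
        (reach-trans (to-backbone m) (reach-edge (adj-sym a)))

    dist-from-leaf : ∀ w → dist adj u w ≡ gap w
    dist-from-leaf w = dist-exact (gap-bound w) (gap-reach w)
      (λ j r → subst (gap w ≤_) (cong (_+ j) gap-self) (reach-lower gap gap-lipschitz r))

    dist-to-leaf : ∀ w → dist adj w u ≡ gap w
    dist-to-leaf w = trans (dist-sym symmetric w u) (dist-from-leaf w)

-- Convexity of the distance along a path, in the shifted and doubled form in
-- which two-way distances from pendent vertices appear.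
module Convexity where

  open import Data.Nat using (_+_; _*_; _≤_; _<_)
  open ℕₚ hiding (_≟_)
  open import Data.Nat.Tactic.RingSolver using (solve-∀)

  twice : ℕ → ℕ
  twice x = x + x

  ∣-∣-split : ∀ a b c e → ∣ (a + b) - (c + e) ∣ ≤ ∣ a - c ∣ + ∣ b - e ∣
  ∣-∣-split a b c e = subst (∣ (a + b) - (c + e) ∣ ≤_) (cong₂ _+_ first (∣m+n-m+o∣≡∣n-o∣ c b e))
    (∣-∣-triangle (a + b) (c + b) (c + e))
    where
    first : ∣ a + b - c + b ∣ ≡ ∣ a - c ∣
    first rewrite +-comm a b | +-comm c b = ∣m+n-m+o∣≡∣n-o∣ b a c

  ∣I+B-I∣ : ∀ I B → ∣ (I + B) - I ∣ ≡ B
  ∣I+B-I∣ I B = trans (m≤n⇒∣n-m∣≡n∸m (m≤m+n I B)) (m+n∸m≡n I B)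

  ∣I-I+B∣ : ∀ I B → ∣ I - (I + B) ∣ ≡ B
  ∣I-I+B∣ I B = trans (∣-∣-comm I (I + B)) (∣I+B-I∣ I B)

  -- With J = I + B and L = J + A, J is the weighted mean (A·I + B·L)/(A + B) ...
  weighted-mean : ∀ I B A → (A + B) * (I + B) ≡ A * I + B * (I + B + A)
  weighted-mean = solve-∀

  -- ... and p ↦ |p − x| is convex.
  convexity : ∀ I B A p → (A + B) * ∣ p - (I + B) ∣ ≤ A * ∣ p - I ∣ + B * ∣ p - (I + B + A) ∣
  convexity I B A p
    rewrite *-distribˡ-∣-∣ (A + B) p (I + B) | *-distribʳ-+ p A B | weighted-mean I B A
          | *-distribˡ-∣-∣ A p I | *-distribˡ-∣-∣ B p (I + B + A) =
    ∣-∣-split (A * p) (B * p) (A * I) (B * (I + B + A))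

  shift-≡ : ∀ A B x h → A * ((x + h) + (x + h)) + B * ((x + h) + (x + h)) ≡ 2 * ((A + B) * x) + 2 * ((A + B) * h)
  shift-≡ = solve-∀

  shift-≡′ : ∀ A B x y h → A * ((x + h) + (x + h)) + B * ((y + h) + (y + h)) ≡ 2 * (A * x + B * y) + 2 * ((A + B) * h)
  shift-≡′ = solve-∀

  convexity-shifted : ∀ {I J L B A} → J ≡ I + B → L ≡ J + A → ∀ p h →
    A * twice (∣ p - J ∣ + h) + B * twice (∣ p - J ∣ + h) ≤ A * twice (∣ p - I ∣ + h) + B * twice (∣ p - L ∣ + h)
  convexity-shifted {I} {B = B} {A} refl refl p h =
    subst₂ _≤_ (sym (shift-≡ A B _ h)) (sym (shift-≡′ A B _ _ h))
      (+-monoˡ-≤ (2 * ((A + B) * h)) (*-monoʳ-≤ 2 (convexity I B A p)))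

  convexity-centre : ∀ {I J L B A} → J ≡ I + B → L ≡ J + A → 0 < A → 0 < B → ∀ h →
    A * twice (∣ J - J ∣ + h) + B * twice (∣ J - J ∣ + h) < A * twice (∣ J - I ∣ + h) + B * twice (∣ J - L ∣ + h)
  convexity-centre {I} {B = suc B} {suc A} refl refl _ _ h
    rewrite ∣n-n∣≡0 (I + suc B) | ∣I+B-I∣ I (suc B) | ∣I-I+B∣ (I + suc B) (suc A) =
    subst₂ _<_ (sym (shift-≡ (suc A) (suc B) 0 h)) (sym (shift-≡′ (suc A) (suc B) (suc B) (suc A) h))
      (+-monoˡ-< (2 * ((suc A + suc B) * h)) (*-monoʳ-< 2 (subst (_< suc A * suc B + suc B * suc A)
        (sym (*-zeroʳ (suc A + suc B))) (s≤s z≤n))))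

  nearer-left : ∀ {I J L B A} → J ≡ I + B → L ≡ J + A → ∣ I - J ∣ ≤ ∣ I - L ∣
  nearer-left {I} {B = B} {A} refl refl
    rewrite ∣I-I+B∣ I B | +-assoc I B A | ∣I-I+B∣ I (B + A) = m≤m+n B A

  nearer-right : ∀ {I J L B A} → J ≡ I + B → L ≡ J + A → ∣ L - J ∣ ≤ ∣ L - I ∣
  nearer-right {I} {B = B} {A} refl refl
    rewrite ∣I+B-I∣ (I + B) A | +-assoc I B A | ∣I+B-I∣ I (B + A) = m≤n+m A B

-- In an optimal tree, two distinct vertices of equal degree may be exchanged
-- without leaving WT(w, d); so their weights are concordant with their
-- transmissions.
module OptimalExchange {c ℓ} (F : OrderedField c ℓ) {n : ℕ} (d : Fin n → ℕ)
    (μ : Fin n → OrderedField.Carrier F) (adj : Adj n) (opt : Optimal F μ d adj) where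

  open OrderedField F
  open OrderedFieldFacts F
  open CommutativeRing commutativeRing using () renaming (refl to ≈-refl; reflexive to ≈-reflexive)

  exchange-optimal : ∀ x y (x≢y : ¬ x ≡ y) → d x ≡ d y →
    let open Exchange F μ x y x≢y in
    Concordant (μ x) (μ y) (transmission (dist adj) x) (transmission (dist adj) y)
  exchange-optimal x y x≢y dx≡dy =
    exchange (dist adj) (dist-self x) (dist-self y) (≤-resp-≈ relabelled≈ ≈-refl (proj₂ opt relabelled member))
    where
    open Exchange F μ x y x≢y
    open Relabel adj (Perm.transpose x y)
    open Walks adj using (dist-self)

    member : InWT F d relabelled
    member = tree-relabel (proj₁ (proj₁ opt)) ,
             λ v → trans (deg-relabel v) (trans (proj₂ (proj₁ opt) (σ v)) (σ-invariant d dx≡dy v))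

    relabelled≈ : twiceVWWI F relabelled μ ≈ Φ (λ u v → dist adj (σ u) (σ v))
    relabelled≈ = ∑-cong (λ u → ∑-cong (λ v → ≈-reflexive (cong (λ k → μ u * μ v * ι k) (dist-relabel u v))))

-- For positions i < j < l, exchanging u j with u i and
-- with u l gives two concordances; convexity of backbone distances combines
-- their transmissions into a strict inequality, whence μ(u l) ≤ μ(u i)
-- implies μ(u j) ≤ μ(u i).
module ThreePoint {c ℓ} (F : OrderedField c ℓ) {n : ℕ} (d : Fin n → ℕ)
    (μ : Fin n → OrderedField.Carrier F) (μ>0 : ∀ w → OrderedField._<_ F (OrderedField.0# F) (μ w))
    (adj : Adj n) (opt : Optimal F μ d adj)
    {q : ℕ} (b : Fin q → Fin n) (cat : IsCaterpillarBackbone adj q b)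
    (u : Fin q → Fin n) (pu : ∀ k → Pendent adj (u k) × adj (u k) (b k) ≡ true) where

  open OrderedField F
  open OrderedFieldFacts F
  open Caterpillar adj (proj₁ (proj₁ opt)) b cat
  open OptimalExchange F d μ adj opt
  open Convexity

  private
    module Leaf k = FromLeaf (u k) k (proj₁ (pu k)) (proj₂ (pu k))

  u-injective : ∀ {i j} → u i ≡ u j → i ≡ j
  u-injective {i} {j} e = IsCaterpillarBackbone.injective cat
    (pendent-unique (proj₁ (pu i)) (proj₂ (pu i)) (subst (λ z → adj z (b j) ≡ true) (sym e) (proj₂ (pu j))))

  u-off-backbone : ∀ k m → ¬ b m ≡ u k
  u-off-backbone k m e = pendent⇒off-backbone (proj₁ (pu k)) (m , e)

  -- Pendent vertices have degree 1, so any two of them may be exchanged.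
  degree-u : ∀ k → d (u k) ≡ 1
  degree-u k = trans (sym (proj₂ (proj₁ opt) (u k))) (proj₁ (pu k))

  profile : Fin q → Fin n → ℕ
  profile k w = dist adj (u k) w ℕ.+ dist adj w (u k)

  profile-other : ∀ k {w} → ¬ w ≡ u k →
    profile k w ≡ twice (∣ toℕ (anchor (place w)) - toℕ k ∣ ℕ.+ height (place w))
  profile-other k {w} w≢uk = cong₂ ℕ._+_
    (trans (Leaf.dist-from-leaf k w) (Leaf.gap-other k w≢uk))
    (trans (Leaf.dist-to-leaf k w) (Leaf.gap-other k w≢uk))

  profile-leaf : ∀ k m → ¬ m ≡ k → profile k (u m) ≡ twice (∣ toℕ m - toℕ k ∣ ℕ.+ 2)
  profile-leaf k m m≢k with place-leaf (proj₁ (pu m)) (proj₂ (pu m))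
  ... | anchor≡m , height≡2 rewrite profile-other k (m≢k ∘ u-injective) | anchor≡m | height≡2 = refl

  profile-spine : ∀ k m → profile k (b m) ≡ twice (∣ toℕ m - toℕ k ∣ ℕ.+ 1)
  profile-spine k m with place-spine m
  ... | anchor≡m , height≡1 rewrite profile-other k (u-off-backbone k m) | anchor≡m | height≡1 = refl

  module _ {i j l : Fin q} (i<j : toℕ i ℕ.< toℕ j) (j<l : toℕ j ℕ.< toℕ l) where

    private
      A B : ℕ
      A = toℕ l ∸ toℕ j
      B = toℕ j ∸ toℕ i

      J≡I+B : toℕ j ≡ toℕ i ℕ.+ B
      J≡I+B = sym (ℕₚ.m+[n∸m]≡n (ℕₚ.<⇒≤ i<j))

      L≡J+A : toℕ l ≡ toℕ j ℕ.+ A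
      L≡J+A = sym (ℕₚ.m+[n∸m]≡n (ℕₚ.<⇒≤ j<l))

      distinct : ∀ {k m} → toℕ k ℕ.< toℕ m → ¬ u k ≡ u m
      distinct k<m e = ℕₚ.<-irrefl (cong toℕ (u-injective e)) k<m

      i≢j : ¬ u i ≡ u j
      i≢j = distinct i<j
      l≢j : ¬ u l ≡ u j
      l≢j = distinct j<l ∘ sym
      i≢l : ¬ u i ≡ u l
      i≢l = distinct (ℕₚ.<-trans i<j j<l)

      module E₁ = Exchange F μ (u i) (u j) i≢j
      module E₂ = Exchange F μ (u l) (u j) l≢j

      twice-mono : ∀ {x y} → x ℕ.≤ y → twice x ℕ.≤ twice y
      twice-mono x≤y = ℕₚ.+-mono-≤ x≤y x≤y

      -- Vertexwise comparison of the combined transmissions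
      --   A·T₁(u j) + B·T₂(u j)  versus  A·T₁(u i) + B·T₂(u l).
      left right : Fin n → ℕ
      left w  = A ℕ.* E₁.othersℕ w (profile j w) ℕ.+ B ℕ.* E₂.othersℕ w (profile j w)
      right w = A ℕ.* E₁.othersℕ w (profile i w) ℕ.+ B ℕ.* E₂.othersℕ w (profile l w)

      pointwise : ∀ w → left w ℕ.≤ right w
      pointwise w with w ≟ u j | w ≟ u i | w ≟ u l
      ... | yes refl | _        | _        = ℕₚ.≤-refl
      ... | no _     | yes refl | yes e    = ⊥-elim (i≢l e)
      ... | no _     | yes refl | no _
        rewrite profile-leaf j i (λ e → i≢j (cong u e)) | profile-leaf l i (λ e → i≢l (cong u e)) =
        ℕₚ.+-monoʳ-≤ (A ℕ.* 0) (ℕₚ.*-monoʳ-≤ B (twice-mono (ℕₚ.+-monoˡ-≤ 2 (nearer-left {toℕ i} J≡I+B L≡J+A))))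
      ... | no _     | no _     | yes refl
        rewrite profile-leaf j l (λ e → l≢j (cong u e)) | profile-leaf i l (λ e → i≢l (cong u (sym e))) =
        ℕₚ.+-monoˡ-≤ (B ℕ.* 0) (ℕₚ.*-monoʳ-≤ A (twice-mono (ℕₚ.+-monoˡ-≤ 2 (nearer-right {toℕ i} J≡I+B L≡J+A))))
      ... | no w≢j   | no w≢i   | no w≢l
        rewrite profile-other j w≢j | profile-other i w≢i | profile-other l w≢l =
        convexity-shifted {toℕ i} J≡I+B L≡J+A (toℕ (anchor (place w))) (height (place w))

      centre : left (b j) ℕ.< right (b j)
      centre with b j ≟ u j | b j ≟ u i | b j ≟ u l
      ... | yes e | _     | _     = ⊥-elim (u-off-backbone j j e)
      ... | no _  | yes e | _     = ⊥-elim (u-off-backbone i j e)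
      ... | no _  | no _  | yes e = ⊥-elim (u-off-backbone l j e)
      ... | no _  | no _  | no _
        rewrite profile-spine j j | profile-spine i j | profile-spine l j =
        convexity-centre {toℕ i} J≡I+B L≡J+A (ℕₚ.m<n⇒0<n∸m j<l) (ℕₚ.m<n⇒0<n∸m i<j) 1

      combined-gap : ι A * E₁.transmission (dist adj) (u j) + ι B * E₂.transmission (dist adj) (u j)
                   < ι A * E₁.transmission (dist adj) (u i) + ι B * E₂.transmission (dist adj) (u l)
      combined-gap = <-resp-≈
        (≈-sym (∑-combine μ A B (λ w → E₁.othersℕ w (profile j w)) (λ w → E₂.othersℕ w (profile j w))))
        (≈-sym (∑-combine μ A B (λ w → E₁.othersℕ w (profile i w)) (λ w → E₂.othersℕ w (profile l w))))
        (∑-weighted-< μ μ>0 pointwise (b j) centre)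
        where open CommutativeRing commutativeRing using () renaming (sym to ≈-sym)

    three-point : μ (u l) ≤ μ (u i) → μ (u j) ≤ μ (u i)
    three-point = concordant-three-point (ι A) (ι B) (ι-nonneg A) (ι-nonneg B)
      (exchange-optimal (u i) (u j) i≢j (trans (degree-u i) (sym (degree-u j))))
      (exchange-optimal (u l) (u j) l≢j (trans (degree-u l) (sym (degree-u j))))
      combined-gap

reverse-backbone : ∀ {n} {adj : Adj n} → IsTree adj → ∀ {q} {b : Fin q → Fin n} →
  IsCaterpillarBackbone adj q b → IsCaterpillarBackbone adj q (b ∘ opposite)
reverse-backbone {adj = adj} T {q} {b} cat = record
  { nonempty    = nonempty
  ; injective   = λ {i} {j} e → trans (sym (opposite-involutive i))
                                  (trans (cong opposite (injective e)) (opposite-involutive j))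
  ; consecutive = λ i j j≡1+i → trans (IsTree.symmetric T (b (opposite i)) (b (opposite j)))
                                      (consecutive (opposite j) (opposite i) (opposite-step i j j≡1+i))
  ; internal⇒on = λ v ¬p → let m , bm≡v = internal⇒on v ¬p in
                           opposite m , trans (cong b (opposite-involutive m)) bm≡v
  ; on⇒internal = on⇒internal ∘ opposite
  }
  where
  open IsCaterpillarBackbone cat
  ∸-step : ∀ a m → a ℕ.< m → m ∸ a ≡ suc (m ∸ suc a)
  ∸-step zero    (suc m) _         = refl
  ∸-step (suc a) (suc m) (s≤s a<m) = ∸-step a m a<m
  opposite-step : ∀ (i j : Fin q) → toℕ j ≡ suc (toℕ i) → toℕ (opposite i) ≡ suc (toℕ (opposite j))
  opposite-step i j j≡1+i = begin
    toℕ (opposite i)            ≡⟨ opposite-prop i ⟩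
    q ∸ suc (toℕ i)             ≡⟨ ∸-step (suc (toℕ i)) q (subst (ℕ._< q) j≡1+i (toℕ<n j)) ⟩
    suc (q ∸ suc (suc (toℕ i))) ≡⟨ cong (λ t → suc (q ∸ suc t)) j≡1+i ⟨
    suc (q ∸ suc (toℕ j))       ≡⟨ cong suc (opposite-prop j) ⟨
    suc (toℕ (opposite j))      ∎
    where open ≡-Reasoning

opposite-< : ∀ {q} {i j : Fin q} → toℕ i ℕ.< toℕ j → toℕ (opposite j) ℕ.< toℕ (opposite i)
opposite-< {q} {i} {j} i<j rewrite opposite-prop i | opposite-prop j = ℕₚ.∸-monoʳ-< (s≤s i<j) (toℕ<n j)

-- A finite sequence in a total order is V-shaped as soon as, for i < j < l,
-- a l ≤ a i forces a j ≤ a i and a i ≤ a l forces a j ≤ a l: split it at a minimum.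
module VShape {c ℓ} (F : OrderedField c ℓ) where

  open OrderedField F
  open OrderedFieldFacts F using (≤-refl)
  open IsTotalOrder isTotalOrder using (total) renaming (trans to ≤-trans)

  minimum : ∀ {q} (a : Fin (suc q) → Carrier) → Σ (Fin (suc q)) λ m → ∀ k → a m ≤ a k
  minimum {zero}  a = zero , λ { zero → ≤-refl }
  minimum {suc q} a with minimum (a ∘ suc)
  ... | m , min with total (a zero) (a (suc m))
  ...   | inj₁ a₀≤ = zero , λ { zero → ≤-refl ; (suc k) → ≤-trans a₀≤ (min k) }
  ...   | inj₂ ≤a₀ = suc m , λ { zero → ≤a₀ ; (suc k) → min k }

  vshaped : ∀ {q} (a : Fin (suc q) → Carrier) →
    (∀ {i j l} → toℕ i ℕ.< toℕ j → toℕ j ℕ.< toℕ l → a l ≤ a i → a j ≤ a i) →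
    (∀ {i j l} → toℕ i ℕ.< toℕ j → toℕ j ℕ.< toℕ l → a i ≤ a l → a j ≤ a l) →
    VShaped F a
  vshaped a descend ascend = m , λ i j j≡1+i → before i j j≡1+i , after i j j≡1+i
    where
    m = proj₁ (minimum a)
    min = proj₂ (minimum a)
    before : ∀ i j → toℕ j ≡ suc (toℕ i) → toℕ j ℕ.≤ toℕ m → a j ≤ a i
    before i j j≡1+i j≤m with ℕₚ.m≤n⇒m<n∨m≡n j≤m
    ... | inj₁ j<m = descend (ℕₚ.≤-reflexive (sym j≡1+i)) j<m (min i)
    ... | inj₂ j≡m rewrite toℕ-injective j≡m = min i
    after : ∀ i j → toℕ j ≡ suc (toℕ i) → toℕ m ℕ.≤ toℕ i → a i ≤ a j
    after i j j≡1+i m≤i with ℕₚ.m≤n⇒m<n∨m≡n m≤i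
    ... | inj₁ m<i = ascend m<i (ℕₚ.≤-reflexive (sym j≡1+i)) (min j)
    ... | inj₂ m≡i rewrite sym (toℕ-injective m≡i) = min j

-- The descending
-- half is the three-point lemma; the ascending half is the three-point lemma
-- for the reversed backbone.
module PendentWeights {c ℓ} (F : OrderedField c ℓ) {n : ℕ} (d : Fin n → ℕ)
    (μ : Fin n → OrderedField.Carrier F) (μ>0 : ∀ w → OrderedField._<_ F (OrderedField.0# F) (μ w))
    (adj : Adj n) (opt : Optimal F μ d adj) where

  open OrderedField F

  vshaped : ∀ {q} (b : Fin (suc q) → Fin n) → IsCaterpillarBackbone adj (suc q) b →
    (u : Fin (suc q) → Fin n) → (∀ k → Pendent adj (u k) × adj (u k) (b k) ≡ true) →
    VShaped F (μ ∘ u)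
  vshaped b cat u pu = VShape.vshaped F (μ ∘ u) (ThreePoint.three-point F d μ μ>0 adj opt b cat u pu) ascending
    where
    reversed = ThreePoint.three-point F d μ μ>0 adj opt (b ∘ opposite)
                 (reverse-backbone (proj₁ (proj₁ opt)) cat) (u ∘ opposite) (pu ∘ opposite)
    ascending : ∀ {i j l} → toℕ i ℕ.< toℕ j → toℕ j ℕ.< toℕ l → μ (u i) ≤ μ (u l) → μ (u j) ≤ μ (u l)
    ascending {i} {j} {l} i<j j<l ui≤ul =
      subst₂ (λ s t → μ (u s) ≤ μ (u t)) (opposite-involutive j) (opposite-involutive l)
        (reversed (opposite-< j<l) (opposite-< i<j)
          (subst₂ (λ s t → μ (u s) ≤ μ (u t)) (sym (opposite-involutive i)) (sym (opposite-involutive l)) ui≤ul))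

open import Data.Nat using (ℕ; _≤_; _<_; _+_; _*_; _∸_)

lemma3 : ∀ {c ℓ} (F : OrderedField c ℓ) (n : ℕ)
    (d : Fin n → ℕ) (μ : Fin n → OrderedField.Carrier F) →
    (∀ (i j : Fin n) → toℕ i ≤ toℕ j → d j ≤ d i) →
    (∀ i → 1 ≤ d i) →
    sumℕ d ≡ 2 * (n ∸ 1) →
    (∀ i → OrderedField._<_ F (OrderedField.0# F) (μ i)) →
    (∀ (i j : Fin n) → d i ≡ d j → toℕ i < toℕ j → OrderedField._≤_ F (μ j) (μ i)) →
    (adj : Adj n) → Optimal F μ d adj →
    (q : ℕ) (b : Fin q → Fin n) → IsCaterpillarBackbone adj q b →
    (u : Fin q → Fin n) →
    (∀ k → Pendent adj (u k) × adj (u k) (b k) ≡ true) →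
    VShaped F (λ k → μ (u k))
lemma3 F n d μ _ _ _ μ>0 _ adj opt zero b cat u pu with IsCaterpillarBackbone.nonempty cat
... | ()
lemma3 F n d μ _ _ _ μ>0 _ adj opt (suc q) b cat u pu = PendentWeights.vshaped F d μ μ>0 adj opt b cat u pu
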